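{- Let $R=\mathrm{GR}(4,m)$ with residue field $K$ and reduction map $\mu:R\to K$. Let $\Sigma=\prod_{i=1}^r(1-Y_iz)^{a_i}\in R[z]$ with $a_i\in\{1,2\}$ and $Y_i\in R$ such that $\mu Y_1,\dots,\mu Y_r\in K^\times$ are pairwise distinct. Then $2\in(\Sigma_{\mathrm{even}},\Sigma_{\mathrm{odd}})$.
   Context: $\mu$ is the canonical map $a\mapsto a+2R$. For $P=\sum_kP_kz^k\in R[z]$, $P_{\mathrm{even}}=\sum_jP_{2j}z^{2j}$ and $P_{\mathrm{odd}}=\sum_jP_{2j+1}z^{2j+1}$. $(f,g)=R[z]f+R[z]g$. -}

module Defs where

open import Data.Nat using (ℕ; zero; suc; _<_; _≤_)
open import Data.Nat.DivMod using (_mod_)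
open import Data.Fin using (Fin; toℕ)
open import Data.Vec using (Vec; []; _∷_; replicate; zipWith; map; toList)
open import Data.List using (List; []; _∷_; foldr; _++_; [_]; tabulate)
open import Data.Product using (Σ; ∃; ∃-syntax; _×_; _,_)
open import Relation.Binary.PropositionalEquality using (_≡_)
open import Relation.Nullary using (¬_)

Z4 : Set
Z4 = Fin 4

_+₄_ _*₄_ : Z4 → Z4 → Z4
a +₄ b = (toℕ a Data.Nat.+ toℕ b) mod 4
a *₄ b = (toℕ a Data.Nat.* toℕ b) mod 4

-₄_ : Z4 → Z4
-₄ a = (4 Data.Nat.∸ toℕ a) mod 4

0₄ 1₄ 2₄ : Z4
0₄ = 0 mod 4
1₄ = 1 mod 4
2₄ = 2 mod 4

F2 : Set
F2 = Fin 2

_+₂_ _*₂_ : F2 → F2 → F2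
a +₂ b = (toℕ a Data.Nat.+ toℕ b) mod 2
a *₂ b = (toℕ a Data.Nat.* toℕ b) mod 2

0₂ 1₂ : F2
0₂ = 0 mod 2
1₂ = 1 mod 2

red : Z4 → F2
red a = toℕ a mod 2

-- Univariate polynomials over a ring A, as coefficient lists
-- (constant term first); equality is coefficientwise.

module Poly {A : Set} (0# : A) (_+_ _*_ : A → A → A) where

  coeff : List A → ℕ → A
  coeff []      _       = 0#
  coeff (a ∷ p) zero    = a
  coeff (a ∷ p) (suc k) = coeff p k

  _≈P_ : List A → List A → Set
  p ≈P q = ∀ k → coeff p k ≡ coeff q k

  addP : List A → List A → List A
  addP []      q       = q
  addP (a ∷ p) []      = a ∷ p
  addP (a ∷ p) (b ∷ q) = (a + b) ∷ addP p q

  scaleP : A → List A → List A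
  scaleP a []      = []
  scaleP a (b ∷ q) = (a * b) ∷ scaleP a q

  mulP : List A → List A → List A
  mulP []      q = []
  mulP (a ∷ p) q = addP (scaleP a q) (0# ∷ mulP p q)

  powP : List A → ℕ → A → List A      -- third argument: the element 1
  powP p zero    one = one ∷ []
  powP p (suc k) one = mulP p (powP p k one)

  -- even and odd parts: P_even = Σ P_{2j} z^{2j}, P_odd = Σ P_{2j+1} z^{2j+1}
  evenP oddP : List A → List A
  evenP []      = []
  evenP (a ∷ p) = a ∷ oddP p
  oddP  []      = []
  oddP  (a ∷ p) = 0# ∷ evenP p

  InIdeal : A → List A → List A → Set
  InIdeal c f g = ∃[ u ] ∃[ v ] (addP (mulP u f) (mulP v g) ≈P (c ∷ []))

  NonConstant : List A → Set
  NonConstant p = ∃[ k ] (1 ≤ k × ¬ (coeff p k ≡ 0#))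

module P2 = Poly 0₂ _+₂_ _*₂_

-- a polynomial f over 𝔽₂ (assumed non-constant) is irreducible iff it is
-- not a product of two non-constant polynomials
Irreducible₂ : List F2 → Set
Irreducible₂ f = ¬ (∃[ g ] ∃[ k ] (P2.NonConstant g × P2.NonConstant k × (f P2.≈P P2.mulP g k)))

-- The Galois ring GR(4,m) = ℤ₄[x]/(h), h = x^m + h_{m-1}x^{m-1} + … + h_0
-- monic with reduction h̄ mod 2 irreducible over 𝔽₂ (a basic irreducible).
-- The monic polynomial h is given by its lower coefficients hl.
-- Elements are canonical representatives: vectors of the m coefficients
-- of a polynomial of degree < m.

hPoly : ∀ {m} → Vec Z4 m → List Z4
hPoly hl = toList hl ++ [ 1₄ ]

hbar : ∀ {m} → Vec Z4 m → List F2
hbar hl = toList (map red hl) ++ [ 1₂ ]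

BasicIrreducible : ∀ {m} → Vec Z4 m → Set
BasicIrreducible hl = Irreducible₂ (hbar hl)

module GR (m : ℕ) (hl : Vec Z4 m) where

  R : Set
  R = Vec Z4 m

  0R 1R 2R : R
  0R = replicate m 0₄
  1R = go m where
    go : (k : ℕ) → Vec Z4 k
    go zero    = []
    go (suc k) = 1₄ ∷ replicate k 0₄
  2R = map (2₄ *₄_) 1R

  _+R_ : R → R → R
  _+R_ = zipWith _+₄_

  -R_ : R → R
  -R_ = map -₄_

  -- shift all coefficients up by one, inserting c at position 0;
  -- returns the shifted vector and the coefficient pushed out at the top
  pushPop : ∀ {k} → Z4 → Vec Z4 k → Vec Z4 k × Z4
  pushPop c []       = [] , c
  pushPop c (a ∷ as) with pushPop a as
  ... | v , t = (c ∷ v) , t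

  -- multiplication by x modulo h  (x^m ≡ -(h_0 + … + h_{m-1} x^{m-1}))
  xmul : R → R
  xmul a with pushPop 0₄ a
  ... | v , t = zipWith (λ s hi → s +₄ (-₄ (t *₄ hi))) v hl

  _·R_ : Z4 → R → R
  c ·R a = map (c *₄_) a

  -- a * b by Horner's rule in b = b_0 + x (b_1 + x (…))
  _*R_ : R → R → R
  a *R b = foldr (λ bk acc → (bk ·R a) +R xmul acc) 0R (toList b)

  -- reduction μ : R → K = R / 2R, realised as K = 𝔽₂[x]/(h̄)
  -- (coefficientwise reduction mod 2)
  K : Set
  K = Vec F2 m

  0K : K
  0K = replicate m 0₂

  μ : R → K
  μ = map red

  module PR = Poly 0R _+R_ _*R_

  prodP : (r : ℕ) → (Fin r → List R) → List R
  prodP zero    f = 1R ∷ []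
  prodP (suc r) f = PR.mulP (f Fin.zero) (prodP r (λ i → f (Fin.suc i)))
    where import Data.Fin as Fin

  Sigma : (r : ℕ) → (Fin r → R) → (Fin r → ℕ) → List R
  Sigma r Y a = prodP r (λ i → PR.powP (1R ∷ (-R Y i) ∷ []) (a i) 1R)

module Submission where

-- Put N(f) = f_even² − f_odd² (= f(z) f(−z)).  The product rule
-- (fg)_even = f_e g_e + f_o g_o, (fg)_odd = f_e g_o + f_o g_e makes N
-- multiplicative, and if 2 ∈ (f_e, f_o), 2 ∈ (g_e, g_o) with N(f), N(g) coprime,
-- then 2 ∈ ((fg)_e, (fg)_o) by an explicit combination.  For the factors
-- (1 − yz)^a, a ∈ {1, 2}, 2 ∈ (f_e, f_o) is checked directly, and
-- N(1 − yz) = 1 − y²z²; two of these norms are coprime as soon as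
-- y_j² − y_i² = (y_j − y_i)(y_j + y_i) is a unit.  In R both factors have
-- nonzero residue, and an element of nonzero residue is a unit: invert its
-- residue in 𝔽₂[x]/(h̄) (h̄ irreducible) and lift the inverse, using 4 = 0.
-- Induction over the factors concludes.

open import Defs
open import Algebra using (CommutativeRing)
open import Algebra.Structures using (IsCommutativeRing)
open import Data.Bool using (Bool; true; false; T)
open import Data.Empty using (⊥-elim)
open import Data.Fin using (Fin; zero; suc)
import Data.Fin.Properties as Fin
open import Data.Fin.Properties using (all?; _≟_)
import Data.Integer as ℤ
open import Data.Integer using (ℤ; +_; -[1+_]; _⊖_; _◃_; ∣_∣; sign)
import Data.Integer.Properties as ℤ
import Data.List as List
open import Data.List using (List; []; _∷_; _++_; length; foldr)
import Data.List.Properties as List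
open import Data.Maybe using (nothing)
import Data.Nat as ℕ
open import Data.Nat using (ℕ; zero; suc; _∸_; _≤_; _<_; z≤n; s≤s) renaming (_+_ to _+ℕ_)
open import Data.Nat.Induction using (<-rec)
import Data.Nat.Properties as ℕ
open import Data.Product using (Σ; _×_; _,_; proj₁; proj₂; swap)
import Data.Sign as Sign
open import Data.Sign using (Sign)
open import Data.Sum using (_⊎_; inj₁; inj₂)
open import Data.Unit using (tt)
import Data.Vec as Vec
open import Data.Vec using (Vec; []; _∷_; replicate; zipWith; map; toList)
import Data.Vec.Properties as Vec
open import Level using (0ℓ)
open import Relation.Binary using (Rel; IsEquivalence)
open import Relation.Binary.PropositionalEquality as ≡ using (_≡_; refl; cong; cong₂; sym; trans; subst; subst₂)
open import Relation.Nullary using (¬_; yes; no)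
open import Relation.Nullary.Decidable using (toWitness; _→-dec_)

-- A ring solver for an arbitrary commutative ring R with integer coefficients:
-- the standard library's normaliser (Tactic.RingSolver.Core) instantiated with
-- the canonical morphism ℤ → R, n ↦ n · 1.  Integer coefficients (rather than
-- coefficients in R itself) are what makes cancellations such as x − x = 0
-- visible to the normaliser.
module IntegerRingSolver {c ℓ} (CR : CommutativeRing c ℓ) where
  open CommutativeRing CR renaming (refl to ≈-refl; sym to ≈-sym; trans to ≈-trans)
  open import Algebra.Properties.Ring ring using (-0#≈0#; -‿distribˡ-*; -‿distribʳ-*; -‿involutive; -‿+-comm)
  open import Algebra.Properties.Semiring.Mult.TCOptimised semiring using (×-homo-+; ×1-homo-*) renaming (_×_ to _·_)
  open import Relation.Binary.Reasoning.Setoid setoid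
  import Tactic.RingSolver.Core.AlmostCommutativeRing as ACR
  open import Tactic.RingSolver.Core.Polynomial.Parameters using (Homomorphism)

  fromℤ : ℤ → Carrier
  fromℤ (+ n)      = n · 1#
  fromℤ -[1+ n ]   = - (suc n · 1#)

  1+× : ∀ n → suc n · 1# ≈ 1# + n · 1#
  1+× n = ×-homo-+ 1# 1 n

  fromℤ-⊖ : ∀ m n → fromℤ (m ⊖ n) ≈ m · 1# - n · 1#
  fromℤ-⊖ zero    zero    = ≈-sym (-‿inverseʳ 0#)
  fromℤ-⊖ zero    (suc n) = ≈-sym (+-identityˡ _)
  fromℤ-⊖ (suc m) zero    = ≈-sym (≈-trans (+-congˡ -0#≈0#) (+-identityʳ _))
  fromℤ-⊖ (suc m) (suc n) rewrite ℤ.[1+m]⊖[1+n]≡m⊖n m n = begin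
    fromℤ (m ⊖ n)                                ≈⟨ fromℤ-⊖ m n ⟩
    m · 1# - n · 1#                          ≈⟨ ≈-sym (+-identityˡ _) ⟩
    0# + (m · 1# - n · 1#)                   ≈⟨ +-congʳ (≈-sym (-‿inverseʳ 1#)) ⟩
    (1# - 1#) + (m · 1# - n · 1#)            ≈⟨ +-assoc _ _ _ ⟩
    1# + (- 1# + (m · 1# - n · 1#))          ≈⟨ +-congˡ (≈-sym (+-assoc _ _ _)) ⟩
    1# + ((- 1# + m · 1#) - n · 1#)          ≈⟨ +-congˡ (+-congʳ (+-comm _ _)) ⟩
    1# + ((m · 1# - 1#) - n · 1#)            ≈⟨ +-congˡ (+-assoc _ _ _) ⟩
    1# + (m · 1# + (- 1# - n · 1#))          ≈⟨ ≈-sym (+-assoc _ _ _) ⟩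
    (1# + m · 1#) + (- 1# - n · 1#)          ≈⟨ +-congˡ (-‿+-comm 1# (n · 1#)) ⟩
    (1# + m · 1#) - (1# + n · 1#)            ≈⟨ ≈-sym (+-cong (1+× m) (-‿cong (1+× n))) ⟩
    suc m · 1# - suc n · 1#                  ∎

  fromℤ-+ : ∀ i j → fromℤ (i ℤ.+ j) ≈ fromℤ i + fromℤ j
  fromℤ-+ (+ m)    (+ n)    = ×-homo-+ 1# m n
  fromℤ-+ (+ m)    -[1+ n ] = fromℤ-⊖ m (suc n)
  fromℤ-+ -[1+ m ] (+ n)    = ≈-trans (fromℤ-⊖ n (suc m)) (+-comm _ _)
  fromℤ-+ -[1+ m ] -[1+ n ] = begin
    - (suc (suc m ℕ.+ n) · 1#)           ≈⟨ -‿cong (reflexive (≡.cong (λ k → suc k · 1#) (≡.sym (ℕ.+-suc m n)))) ⟩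
    - ((suc m ℕ.+ suc n) · 1#)           ≈⟨ -‿cong (×-homo-+ 1# (suc m) (suc n)) ⟩
    - (suc m · 1# + suc n · 1#)          ≈⟨ ≈-sym (-‿+-comm _ _) ⟩
    - (suc m · 1#) - (suc n · 1#)        ∎

  signed : Sign → Carrier → Carrier
  signed Sign.+ x = x
  signed Sign.- x = - x

  signed-cong : ∀ s {x y} → x ≈ y → signed s x ≈ signed s y
  signed-cong Sign.+ p = p
  signed-cong Sign.- p = -‿cong p

  signed-* : ∀ s t x y → signed (s Sign.* t) (x * y) ≈ signed s x * signed t y
  signed-* Sign.+ Sign.+ x y = ≈-refl
  signed-* Sign.+ Sign.- x y = -‿distribʳ-* x y
  signed-* Sign.- Sign.+ x y = -‿distribˡ-* x y
  signed-* Sign.- Sign.- x y = begin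
    x * y              ≈⟨ ≈-sym (-‿involutive _) ⟩
    - - (x * y)        ≈⟨ -‿cong (-‿distribʳ-* x y) ⟩
    - (x * - y)        ≈⟨ -‿distribˡ-* x (- y) ⟩
    - x * - y          ∎

  fromℤ-◃ : ∀ s n → fromℤ (s ◃ n) ≈ signed s (n · 1#)
  fromℤ-◃ Sign.+ zero    = ≈-refl
  fromℤ-◃ Sign.+ (suc n) = ≈-refl
  fromℤ-◃ Sign.- zero    = ≈-sym -0#≈0#
  fromℤ-◃ Sign.- (suc n) = ≈-refl

  fromℤ-sign : ∀ i → fromℤ i ≈ signed (sign i) (∣ i ∣ · 1#)
  fromℤ-sign (+ n)    = ≈-refl
  fromℤ-sign -[1+ n ] = ≈-refl

  fromℤ-* : ∀ i j → fromℤ (i ℤ.* j) ≈ fromℤ i * fromℤ j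
  fromℤ-* i j = begin
    fromℤ (sign i Sign.* sign j ◃ ∣ i ∣ ℕ.* ∣ j ∣)                    ≈⟨ fromℤ-◃ (sign i Sign.* sign j) (∣ i ∣ ℕ.* ∣ j ∣) ⟩
    signed (sign i Sign.* sign j) ((∣ i ∣ ℕ.* ∣ j ∣) · 1#)         ≈⟨ signed-cong (sign i Sign.* sign j) (×1-homo-* ∣ i ∣ ∣ j ∣) ⟩
    signed (sign i Sign.* sign j) (∣ i ∣ · 1# * ∣ j ∣ · 1#)        ≈⟨ signed-* (sign i) (sign j) _ _ ⟩
    signed (sign i) (∣ i ∣ · 1#) * signed (sign j) (∣ j ∣ · 1#)    ≈⟨ ≈-sym (*-cong (fromℤ-sign i) (fromℤ-sign j)) ⟩
    fromℤ i * fromℤ j                                                      ∎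

  fromℤ-neg : ∀ i → fromℤ (ℤ.- i) ≈ - fromℤ i
  fromℤ-neg (+ zero)    = ≈-sym -0#≈0#
  fromℤ-neg (+ suc n)   = ≈-refl
  fromℤ-neg -[1+ n ]    = ≈-sym (-‿involutive _)

  private
    isZero : ℤ → Bool
    isZero (+ zero) = true
    isZero _        = false

    isZero-sound : ∀ i → T (isZero i) → 0# ≈ fromℤ i
    isZero-sound (+ zero) _ = ≈-refl

    homomorphism : Homomorphism 0ℓ 0ℓ c ℓ
    homomorphism = record
      { from          = record { rawRing = ℤ.+-*-rawRing ; isZero = isZero }
      ; to            = ACR.fromCommutativeRing CR (λ _ → nothing)
      ; morphism      = record
        { ⟦_⟧ = fromℤ ; +-homo = fromℤ-+ ; *-homo = fromℤ-* ; -‿homo = fromℤ-neg ; 0-homo = ≈-refl ; 1-homo = ≈-refl }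
      ; Zero-C⟶Zero-R = isZero-sound
      }

  open import Tactic.RingSolver.Core.Expression public using (Κ; _⊕_; _⊗_; ⊝_)
  open import Tactic.RingSolver.Core.Expression using (Expr; Ι; _⊛_; module Eval)
  open Eval rawRing fromℤ using (⟦_⟧)
  open import Tactic.RingSolver.Core.Polynomial.Base (Homomorphism.from homomorphism)
  open import Tactic.RingSolver.Core.Polynomial.Semantics homomorphism renaming (⟦_⟧ to ⟦_⟧ₚ)
  open import Tactic.RingSolver.Core.Polynomial.Homomorphism homomorphism
  open import Algebra.Properties.Semiring.Exp.TCOptimised semiring using (^-congˡ)

  private
    normalise : ∀ {n} → Expr ℤ n → Poly n
    normalise (Κ x)   = κ x
    normalise (Ι x)   = ι x
    normalise (x ⊕ y) = normalise x ⊞ normalise y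
    normalise (x ⊗ y) = normalise x ⊠ normalise y
    normalise (⊝ x)   = ⊟ normalise x
    normalise (x ⊛ i) = normalise x ⊡ i

    ⟦_⇓⟧ : ∀ {n} → Expr ℤ n → Vec Carrier n → Carrier
    ⟦ e ⇓⟧ = ⟦ normalise e ⟧ₚ

    correct : ∀ {n} (e : Expr ℤ n) ρ → ⟦ e ⇓⟧ ρ ≈ ⟦ e ⟧ ρ
    correct (Κ x)   ρ = κ-hom x ρ
    correct (Ι x)   ρ = ι-hom x ρ
    correct (x ⊕ y) ρ = ≈-trans (⊞-hom (normalise x) (normalise y) ρ) (+-cong (correct x ρ) (correct y ρ))
    correct (x ⊗ y) ρ = ≈-trans (⊠-hom (normalise x) (normalise y) ρ) (*-cong (correct x ρ) (correct y ρ))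
    correct (⊝ x)   ρ = ≈-trans (⊟-hom (normalise x) ρ) (-‿cong (correct x ρ))
    correct (x ⊛ i) ρ = ≈-trans (⊡-hom (normalise x) i ρ) (^-congˡ i (correct x ρ))

  open import Relation.Binary.Reflection setoid Ι ⟦_⟧ ⟦_⇓⟧ correct public using (solve; _⊜_)

-- A commutative ring structure on a type with propositional equality (or any
-- equivalence), from a minimal list of axioms; the remaining ones (right
-- identities, right inverse, left distributivity) follow by commutativity.
record CommutativeRingLaws {A : Set} (_≈_ : Rel A 0ℓ) (_+_ _*_ : A → A → A) (-_ : A → A) (0# 1# : A) : Set where
  field
    isEquivalence : IsEquivalence _≈_
    +-cong   : ∀ {a b c d} → a ≈ b → c ≈ d → (a + c) ≈ (b + d)
    *-cong   : ∀ {a b c d} → a ≈ b → c ≈ d → (a * c) ≈ (b * d)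
    -‿cong   : ∀ {a b} → a ≈ b → (- a) ≈ (- b)
    +-assoc  : ∀ a b c → ((a + b) + c) ≈ (a + (b + c))
    +-comm   : ∀ a b → (a + b) ≈ (b + a)
    +-identityˡ : ∀ a → (0# + a) ≈ a
    -‿inverseˡ  : ∀ a → ((- a) + a) ≈ 0#
    *-assoc  : ∀ a b c → ((a * b) * c) ≈ (a * (b * c))
    *-comm   : ∀ a b → (a * b) ≈ (b * a)
    *-identityˡ : ∀ a → (1# * a) ≈ a
    distribʳ : ∀ a b c → ((b + c) * a) ≈ ((b * a) + (c * a))

  open IsEquivalence isEquivalence using () renaming (trans to _⟨≈⟩_)

  isCommutativeRing : IsCommutativeRing _≈_ _+_ _*_ -_ 0# 1#
  isCommutativeRing = record
    { isRing = record
      { +-isAbelianGroup = record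
        { isGroup = record
          { isMonoid = record
            { isSemigroup = record
              { isMagma = record { isEquivalence = isEquivalence ; ∙-cong = +-cong }
              ; assoc = +-assoc }
            ; identity = +-identityˡ , λ a → +-comm a 0# ⟨≈⟩ +-identityˡ a }
          ; inverse = -‿inverseˡ , λ a → +-comm a (- a) ⟨≈⟩ -‿inverseˡ a
          ; ⁻¹-cong = -‿cong }
        ; comm = +-comm }
      ; *-cong = *-cong
      ; *-assoc = *-assoc
      ; *-identity = *-identityˡ , λ a → *-comm a 1# ⟨≈⟩ *-identityˡ a
      ; distrib = (λ a b c → *-comm a (b + c) ⟨≈⟩ (distribʳ a b c ⟨≈⟩ +-cong (*-comm b a) (*-comm c a)))
                  , distribʳ }
    ; *-comm = *-comm }

  commutativeRing : CommutativeRing 0ℓ 0ℓ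
  commutativeRing = record { isCommutativeRing = isCommutativeRing }

-- ℤ/4 and 𝔽₂ are commutative rings: each axiom is a statement about finitely
-- many residues and is checked by evaluation.
ℤ₄-laws : CommutativeRingLaws _≡_ _+₄_ _*₄_ -₄_ 0₄ 1₄
ℤ₄-laws = record
  { isEquivalence = ≡.isEquivalence
  ; +-cong = cong₂ _+₄_ ; *-cong = cong₂ _*₄_ ; -‿cong = cong -₄_
  ; +-assoc     = toWitness {a? = all? λ a → all? λ b → all? λ c → ((a +₄ b) +₄ c) ≟ (a +₄ (b +₄ c))} tt
  ; +-comm      = toWitness {a? = all? λ a → all? λ b → (a +₄ b) ≟ (b +₄ a)} tt
  ; +-identityˡ = toWitness {a? = all? λ a → (0₄ +₄ a) ≟ a} tt
  ; -‿inverseˡ  = toWitness {a? = all? λ a → ((-₄ a) +₄ a) ≟ 0₄} tt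
  ; *-assoc     = toWitness {a? = all? λ a → all? λ b → all? λ c → ((a *₄ b) *₄ c) ≟ (a *₄ (b *₄ c))} tt
  ; *-comm      = toWitness {a? = all? λ a → all? λ b → (a *₄ b) ≟ (b *₄ a)} tt
  ; *-identityˡ = toWitness {a? = all? λ a → (1₄ *₄ a) ≟ a} tt
  ; distribʳ    = toWitness {a? = all? λ a → all? λ b → all? λ c → ((b +₄ c) *₄ a) ≟ ((b *₄ a) +₄ (c *₄ a))} tt
  }

-- in characteristic 2 negation is the identity
-₂_ : F2 → F2
-₂ a = a

𝔽₂-laws : CommutativeRingLaws _≡_ _+₂_ _*₂_ -₂_ 0₂ 1₂
𝔽₂-laws = record
  { isEquivalence = ≡.isEquivalence
  ; +-cong = cong₂ _+₂_ ; *-cong = cong₂ _*₂_ ; -‿cong = cong -₂_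
  ; +-assoc     = toWitness {a? = all? λ a → all? λ b → all? λ c → ((a +₂ b) +₂ c) ≟ (a +₂ (b +₂ c))} tt
  ; +-comm      = toWitness {a? = all? λ a → all? λ b → (a +₂ b) ≟ (b +₂ a)} tt
  ; +-identityˡ = toWitness {a? = all? λ a → (0₂ +₂ a) ≟ a} tt
  ; -‿inverseˡ  = toWitness {a? = all? λ a → ((-₂ a) +₂ a) ≟ 0₂} tt
  ; *-assoc     = toWitness {a? = all? λ a → all? λ b → all? λ c → ((a *₂ b) *₂ c) ≟ (a *₂ (b *₂ c))} tt
  ; *-comm      = toWitness {a? = all? λ a → all? λ b → (a *₂ b) ≟ (b *₂ a)} tt
  ; *-identityˡ = toWitness {a? = all? λ a → (1₂ *₂ a) ≟ a} tt
  ; distribʳ    = toWitness {a? = all? λ a → all? λ b → all? λ c → ((b +₂ c) *₂ a) ≟ ((b *₂ a) +₂ (c *₂ a))} tt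
  }

module Polynomials {A : Set} {_+_ _*_ : A → A → A} { -_ : A → A} {0# 1# : A}
  (laws : CommutativeRingLaws _≡_ _+_ _*_ -_ 0# 1#) where

  open Poly 0# _+_ _*_ public
  open CommutativeRingLaws laws
  open IntegerRingSolver commutativeRing using (solve; _⊜_; _⊕_; _⊗_; ⊝_; Κ)
  open ≡.≡-Reasoning

  x+0≡x : ∀ x → (x + 0#) ≡ x
  x+0≡x x = trans (+-comm x 0#) (+-identityˡ x)

  x*0≡0 : ∀ x → (x * 0#) ≡ 0#
  x*0≡0 = solve 1 (λ x → x ⊗ Κ (+ 0) ⊜ Κ (+ 0)) refl

  0*x≡0 : ∀ x → (0# * x) ≡ 0#
  0*x≡0 x = trans (*-comm 0# x) (x*0≡0 x)

  -0≡0 : (- 0#) ≡ 0#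
  -0≡0 = solve 0 (⊝ Κ (+ 0) ⊜ Κ (+ 0)) refl

  negP : List A → List A
  negP = List.map -_

  1P : List A
  1P = 1# ∷ []

  const : A → List A
  const a = a ∷ []

  𝕫 : List A
  𝕫 = 0# ∷ 1# ∷ []

  coeff-addP : ∀ p q k → coeff (addP p q) k ≡ (coeff p k + coeff q k)
  coeff-addP []      q       k       = sym (+-identityˡ _)
  coeff-addP (a ∷ p) []      k       = sym (x+0≡x _)
  coeff-addP (a ∷ p) (b ∷ q) zero    = refl
  coeff-addP (a ∷ p) (b ∷ q) (suc k) = coeff-addP p q k

  coeff-scaleP : ∀ a q k → coeff (scaleP a q) k ≡ (a * coeff q k)
  coeff-scaleP a []      k       = sym (x*0≡0 a)
  coeff-scaleP a (b ∷ q) zero    = refl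
  coeff-scaleP a (b ∷ q) (suc k) = coeff-scaleP a q k

  coeff-negP : ∀ p k → coeff (negP p) k ≡ (- coeff p k)
  coeff-negP []      k       = sym -0≡0
  coeff-negP (a ∷ p) zero    = refl
  coeff-negP (a ∷ p) (suc k) = coeff-negP p k

  -- the Cauchy product of coefficient sequences: (f ⋆ g) k = Σ_{i+j=k} f i g j
  _⋆_ : (ℕ → A) → (ℕ → A) → ℕ → A
  (f ⋆ g) zero    = f 0 * g 0
  (f ⋆ g) (suc k) = (f 0 * g (suc k)) + ((λ i → f (suc i)) ⋆ g) k

  ⋆-cong : ∀ {f f' g g'} → (∀ i → f i ≡ f' i) → (∀ i → g i ≡ g' i) → ∀ k → (f ⋆ g) k ≡ (f' ⋆ g') k
  ⋆-cong ef eg zero    = cong₂ _*_ (ef 0) (eg 0)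
  ⋆-cong ef eg (suc k) = cong₂ _+_ (cong₂ _*_ (ef 0) (eg (suc k))) (⋆-cong (λ i → ef (suc i)) eg k)

  0⋆g : ∀ g k → ((λ _ → 0#) ⋆ g) k ≡ 0#
  0⋆g g zero    = 0*x≡0 _
  0⋆g g (suc k) = trans (cong₂ _+_ (0*x≡0 _) (0⋆g g k)) (+-identityˡ 0#)

  ⋆-distribʳ : ∀ f f' g k → ((λ i → f i + f' i) ⋆ g) k ≡ ((f ⋆ g) k + (f' ⋆ g) k)
  ⋆-distribʳ f f' g zero    = distribʳ (g 0) (f 0) (f' 0)
  ⋆-distribʳ f f' g (suc k) =
    trans (cong (_+_ ((f 0 + f' 0) * g (suc k))) (⋆-distribʳ (λ i → f (suc i)) (λ i → f' (suc i)) g k))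
          (solve 5 (λ a b x y z → (a ⊕ b) ⊗ x ⊕ (y ⊕ z) ⊜ (a ⊗ x ⊕ y) ⊕ (b ⊗ x ⊕ z)) refl
                   (f 0) (f' 0) (g (suc k)) _ _)

  coeff-mulP : ∀ p q k → coeff (mulP p q) k ≡ (coeff p ⋆ coeff q) k
  coeff-mulP []      q k       = sym (0⋆g (coeff q) k)
  coeff-mulP (a ∷ p) q zero    = trans (coeff-addP (scaleP a q) _ 0) (trans (x+0≡x _) (coeff-scaleP a q 0))
  coeff-mulP (a ∷ p) q (suc k) = trans (coeff-addP (scaleP a q) _ (suc k))
                                       (cong₂ _+_ (coeff-scaleP a q (suc k)) (coeff-mulP p q k))

  -- coefficientwise equality, wrapped in a record so that the two
  -- polynomials can be inferred from a proof
  infix 4 _≋_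
  record _≋_ (p q : List A) : Set where
    constructor coeffwise
    field coeff-≡ : p ≈P q
  open _≋_ public

  ≋-refl : ∀ {p} → p ≋ p
  ≋-refl = coeffwise λ k → refl

  ≋-sym : ∀ {p q} → p ≋ q → q ≋ p
  ≋-sym (coeffwise e) = coeffwise λ k → sym (e k)

  ≋-trans : ∀ {p q r} → p ≋ q → q ≋ r → p ≋ r
  ≋-trans (coeffwise e) (coeffwise f) = coeffwise λ k → trans (e k) (f k)

  ∷-cong : ∀ {a b p q} → a ≡ b → p ≋ q → (a ∷ p) ≋ (b ∷ q)
  ∷-cong e (coeffwise f) = coeffwise λ { zero → e ; (suc k) → f k }

  [0]≋[] : (0# ∷ []) ≋ []
  [0]≋[] = coeffwise λ { zero → refl ; (suc k) → refl }

  addP-cong : ∀ {p p' q q'} → p ≋ p' → q ≋ q' → addP p q ≋ addP p' q'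
  addP-cong {p} {p'} {q} {q'} (coeffwise e) (coeffwise f) = coeffwise λ k →
    trans (coeff-addP p q k) (trans (cong₂ _+_ (e k) (f k)) (sym (coeff-addP p' q' k)))

  mulP-cong : ∀ {p p' q q'} → p ≋ p' → q ≋ q' → mulP p q ≋ mulP p' q'
  mulP-cong {p} {p'} {q} {q'} (coeffwise e) (coeffwise f) = coeffwise λ k →
    trans (coeff-mulP p q k) (trans (⋆-cong e f k) (sym (coeff-mulP p' q' k)))

  negP-cong : ∀ {p p'} → p ≋ p' → negP p ≋ negP p'
  negP-cong {p} {p'} (coeffwise e) = coeffwise λ k →
    trans (coeff-negP p k) (trans (cong -_ (e k)) (sym (coeff-negP p' k)))

  addP-assoc : ∀ p q r → addP (addP p q) r ≋ addP p (addP q r)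
  addP-assoc p q r = coeffwise λ k → begin
    coeff (addP (addP p q) r) k            ≡⟨ coeff-addP (addP p q) r k ⟩
    coeff (addP p q) k + coeff r k         ≡⟨ cong (_+ coeff r k) (coeff-addP p q k) ⟩
    (coeff p k + coeff q k) + coeff r k    ≡⟨ +-assoc _ _ _ ⟩
    coeff p k + (coeff q k + coeff r k)    ≡⟨ cong (_+_ (coeff p k)) (coeff-addP q r k) ⟨
    coeff p k + coeff (addP q r) k         ≡⟨ coeff-addP p (addP q r) k ⟨
    coeff (addP p (addP q r)) k            ∎

  addP-comm : ∀ p q → addP p q ≋ addP q p
  addP-comm p q = coeffwise λ k → trans (coeff-addP p q k) (trans (+-comm _ _) (sym (coeff-addP q p k)))

  addP-identityʳ : ∀ p → addP p [] ≋ p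
  addP-identityʳ p = coeffwise λ k → trans (coeff-addP p [] k) (x+0≡x _)

  negP-inverseˡ : ∀ p → addP (negP p) p ≋ []
  negP-inverseˡ p = coeffwise λ k →
    trans (coeff-addP (negP p) p k) (trans (cong (_+ coeff p k) (coeff-negP p k)) (-‿inverseˡ _))

  scaleP-0 : ∀ p → scaleP 0# p ≋ []
  scaleP-0 p = coeffwise λ k → trans (coeff-scaleP 0# p k) (0*x≡0 _)

  mulP-[]ʳ : ∀ p → mulP p [] ≋ []
  mulP-[]ʳ p = coeffwise (go p)
    where
    go : ∀ p → mulP p [] ≈P []
    go []      k       = refl
    go (a ∷ p) zero    = refl
    go (a ∷ p) (suc k) = go p k

  mulP-distribʳ : ∀ p q r → mulP (addP p q) r ≋ addP (mulP p r) (mulP q r)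
  mulP-distribʳ p q r = coeffwise λ k → begin
    coeff (mulP (addP p q) r) k                          ≡⟨ coeff-mulP (addP p q) r k ⟩
    (coeff (addP p q) ⋆ coeff r) k                       ≡⟨ ⋆-cong (coeff-addP p q) (λ i → refl) k ⟩
    ((λ i → coeff p i + coeff q i) ⋆ coeff r) k          ≡⟨ ⋆-distribʳ (coeff p) (coeff q) (coeff r) k ⟩
    ((coeff p ⋆ coeff r) k + (coeff q ⋆ coeff r) k)      ≡⟨ cong₂ _+_ (coeff-mulP p r k) (coeff-mulP q r k) ⟨
    coeff (mulP p r) k + coeff (mulP q r) k              ≡⟨ coeff-addP (mulP p r) (mulP q r) k ⟨
    coeff (addP (mulP p r) (mulP q r)) k                 ∎

  scaleP-addP : ∀ a p q → scaleP a (addP p q) ≋ addP (scaleP a p) (scaleP a q)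
  scaleP-addP a p q = coeffwise λ k → begin
    coeff (scaleP a (addP p q)) k                        ≡⟨ coeff-scaleP a (addP p q) k ⟩
    a * coeff (addP p q) k                               ≡⟨ cong (a *_) (coeff-addP p q k) ⟩
    a * (coeff p k + coeff q k)                          ≡⟨ CommutativeRing.distribˡ commutativeRing a _ _ ⟩
    (a * coeff p k) + (a * coeff q k)                    ≡⟨ cong₂ _+_ (coeff-scaleP a p k) (coeff-scaleP a q k) ⟨
    coeff (scaleP a p) k + coeff (scaleP a q) k          ≡⟨ coeff-addP (scaleP a p) (scaleP a q) k ⟨
    coeff (addP (scaleP a p) (scaleP a q)) k             ∎

  scaleP-scaleP : ∀ a b p → scaleP a (scaleP b p) ≋ scaleP (a * b) p
  scaleP-scaleP a b p = coeffwise λ k →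
    trans (coeff-scaleP a (scaleP b p) k) (trans (cong (a *_) (coeff-scaleP b p k))
          (trans (sym (*-assoc _ _ _)) (sym (coeff-scaleP (a * b) p k))))

  addP-swap : ∀ x y z → addP x (addP y z) ≋ addP y (addP x z)
  addP-swap x y z = ≋-trans (≋-sym (addP-assoc x y z))
                            (≋-trans (addP-cong (addP-comm x y) ≋-refl) (addP-assoc y x z))

  mulP-∷ʳ : ∀ q a p → mulP q (a ∷ p) ≋ addP (scaleP a q) (0# ∷ mulP q p)
  mulP-∷ʳ []      a p = coeffwise λ { zero → refl ; (suc k) → refl }
  mulP-∷ʳ (b ∷ q) a p = ∷-cong (cong (_+ 0#) (*-comm b a))
    (≋-trans (addP-cong ≋-refl (mulP-∷ʳ q a p)) (addP-swap (scaleP b p) (scaleP a q) (0# ∷ mulP q p)))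

  mulP-comm : ∀ p q → mulP p q ≋ mulP q p
  mulP-comm []      q = ≋-sym (mulP-[]ʳ q)
  mulP-comm (a ∷ p) q = ≋-trans (addP-cong ≋-refl (∷-cong refl (mulP-comm p q))) (≋-sym (mulP-∷ʳ q a p))

  scaleP-mulP : ∀ a q r → mulP (scaleP a q) r ≋ scaleP a (mulP q r)
  scaleP-mulP a []      r = ≋-refl
  scaleP-mulP a (b ∷ q) r =
    ≋-trans (addP-cong (≋-sym (scaleP-scaleP a b r)) (∷-cong (sym (x*0≡0 a)) (scaleP-mulP a q r)))
            (≋-sym (scaleP-addP a (scaleP b r) (0# ∷ mulP q r)))

  mulP-assoc : ∀ p q r → mulP (mulP p q) r ≋ mulP p (mulP q r)
  mulP-assoc []      q r = ≋-refl
  mulP-assoc (a ∷ p) q r = ≋-trans (mulP-distribʳ (scaleP a q) (0# ∷ mulP p q) r)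
    (addP-cong (scaleP-mulP a q r) (≋-trans (addP-cong (scaleP-0 r) ≋-refl) (∷-cong refl (mulP-assoc p q r))))

  mulP-identityˡ : ∀ p → mulP 1P p ≋ p
  mulP-identityˡ p = coeffwise λ k →
    trans (coeff-addP (scaleP 1# p) (0# ∷ []) k)
          (trans (cong₂ _+_ (coeff-scaleP 1# p k) (coeff-≡ [0]≋[] k)) (trans (x+0≡x _) (*-identityˡ _)))

  polynomial-laws : CommutativeRingLaws _≋_ addP mulP negP [] 1P
  polynomial-laws = record
    { isEquivalence = record { refl = ≋-refl ; sym = ≋-sym ; trans = ≋-trans }
    ; +-cong = addP-cong ; *-cong = mulP-cong ; -‿cong = negP-cong
    ; +-assoc = addP-assoc ; +-comm = addP-comm ; +-identityˡ = λ p → ≋-refl ; -‿inverseˡ = negP-inverseˡ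
    ; *-assoc = mulP-assoc ; *-comm = mulP-comm ; *-identityˡ = mulP-identityˡ
    ; distribʳ = λ a b c → mulP-distribʳ b c a }

  polynomialRing : CommutativeRing 0ℓ 0ℓ
  polynomialRing = CommutativeRingLaws.commutativeRing polynomial-laws

  module PolynomialSolver = IntegerRingSolver polynomialRing

  ifEven ifOdd : ℕ → A → A
  ifEven zero    x = x
  ifEven (suc k) x = ifOdd k x
  ifOdd  zero    x = 0#
  ifOdd  (suc k) x = ifEven k x

  KeepOrKill : (A → A) → Set
  KeepOrKill f = (∀ x → f x ≡ x) ⊎ (∀ x → f x ≡ 0#)

  parity : ∀ k → KeepOrKill (ifEven k) × KeepOrKill (ifOdd k)
  parity zero    = inj₁ (λ _ → refl) , inj₂ (λ _ → refl)
  parity (suc k) = swap (parity k)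

  keepOrKill-0 : ∀ {f} → KeepOrKill f → f 0# ≡ 0#
  keepOrKill-0 (inj₁ keep) = keep 0#
  keepOrKill-0 (inj₂ kill) = kill 0#

  keepOrKill-+ : ∀ {f} → KeepOrKill f → ∀ x y → f (x + y) ≡ (f x + f y)
  keepOrKill-+ (inj₁ keep) x y = trans (keep _) (sym (cong₂ _+_ (keep x) (keep y)))
  keepOrKill-+ (inj₂ kill) x y = trans (kill _) (sym (trans (cong₂ _+_ (kill x) (kill y)) (+-identityˡ 0#)))

  keepOrKill-* : ∀ {f} → KeepOrKill f → ∀ a x → f (a * x) ≡ (a * f x)
  keepOrKill-* (inj₁ keep) a x = trans (keep _) (sym (cong (a *_) (keep x)))
  keepOrKill-* (inj₂ kill) a x = trans (kill _) (sym (trans (cong (a *_) (kill x)) (x*0≡0 a)))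

  coeff-evenP : ∀ p k → coeff (evenP p) k ≡ ifEven k (coeff p k)
  coeff-oddP  : ∀ p k → coeff (oddP p) k ≡ ifOdd k (coeff p k)
  coeff-evenP []      k       = sym (keepOrKill-0 (proj₁ (parity k)))
  coeff-evenP (a ∷ p) zero    = refl
  coeff-evenP (a ∷ p) (suc k) = coeff-oddP p k
  coeff-oddP  []      k       = sym (keepOrKill-0 (proj₂ (parity k)))
  coeff-oddP  (a ∷ p) zero    = refl
  coeff-oddP  (a ∷ p) (suc k) = coeff-evenP p k

  evenP-cong : ∀ {p q} → p ≋ q → evenP p ≋ evenP q
  evenP-cong {p} {q} (coeffwise e) = coeffwise λ k →
    trans (coeff-evenP p k) (trans (cong (ifEven k) (e k)) (sym (coeff-evenP q k)))

  oddP-cong : ∀ {p q} → p ≋ q → oddP p ≋ oddP q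
  oddP-cong {p} {q} (coeffwise e) = coeffwise λ k →
    trans (coeff-oddP p k) (trans (cong (ifOdd k) (e k)) (sym (coeff-oddP q k)))

  evenP-addP : ∀ p q → evenP (addP p q) ≋ addP (evenP p) (evenP q)
  evenP-addP p q = coeffwise λ k → begin
    coeff (evenP (addP p q)) k                        ≡⟨ coeff-evenP (addP p q) k ⟩
    ifEven k (coeff (addP p q) k)                     ≡⟨ cong (ifEven k) (coeff-addP p q k) ⟩
    ifEven k (coeff p k + coeff q k)                  ≡⟨ keepOrKill-+ (proj₁ (parity k)) _ _ ⟩
    (ifEven k (coeff p k) + ifEven k (coeff q k))     ≡⟨ cong₂ _+_ (coeff-evenP p k) (coeff-evenP q k) ⟨
    (coeff (evenP p) k + coeff (evenP q) k)           ≡⟨ coeff-addP (evenP p) (evenP q) k ⟨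
    coeff (addP (evenP p) (evenP q)) k                ∎

  oddP-addP : ∀ p q → oddP (addP p q) ≋ addP (oddP p) (oddP q)
  oddP-addP p q = coeffwise λ k → begin
    coeff (oddP (addP p q)) k                         ≡⟨ coeff-oddP (addP p q) k ⟩
    ifOdd k (coeff (addP p q) k)                      ≡⟨ cong (ifOdd k) (coeff-addP p q k) ⟩
    ifOdd k (coeff p k + coeff q k)                   ≡⟨ keepOrKill-+ (proj₂ (parity k)) _ _ ⟩
    (ifOdd k (coeff p k) + ifOdd k (coeff q k))       ≡⟨ cong₂ _+_ (coeff-oddP p k) (coeff-oddP q k) ⟨
    (coeff (oddP p) k + coeff (oddP q) k)             ≡⟨ coeff-addP (oddP p) (oddP q) k ⟨
    coeff (addP (oddP p) (oddP q)) k                  ∎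

  evenP-scaleP : ∀ a p → evenP (scaleP a p) ≋ scaleP a (evenP p)
  evenP-scaleP a p = coeffwise λ k →
    trans (coeff-evenP (scaleP a p) k) (trans (cong (ifEven k) (coeff-scaleP a p k))
      (trans (keepOrKill-* (proj₁ (parity k)) _ _)
      (sym (trans (coeff-scaleP a (evenP p) k) (cong (a *_) (coeff-evenP p k))))))

  oddP-scaleP : ∀ a p → oddP (scaleP a p) ≋ scaleP a (oddP p)
  oddP-scaleP a p = coeffwise λ k →
    trans (coeff-oddP (scaleP a p) k) (trans (cong (ifOdd k) (coeff-scaleP a p k))
      (trans (keepOrKill-* (proj₂ (parity k)) _ _)
      (sym (trans (coeff-scaleP a (oddP p) k) (cong (a *_) (coeff-oddP p k))))))

  const-mulP : ∀ a p → mulP (const a) p ≋ scaleP a p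
  const-mulP a p = ≋-trans (addP-cong ≋-refl [0]≋[]) (addP-identityʳ _)

  𝕫-mulP : ∀ p → mulP 𝕫 p ≋ (0# ∷ p)
  𝕫-mulP p = addP-cong (scaleP-0 p) (∷-cong refl (mulP-identityˡ p))

  ∷-as-sum : ∀ a p → (a ∷ p) ≋ addP (const a) (mulP 𝕫 p)
  ∷-as-sum a p = ≋-trans (∷-cong (sym (x+0≡x a)) ≋-refl) (addP-cong {const a} ≋-refl (≋-sym (𝕫-mulP p)))

  -- By induction on p, writing a ∷ p = a + z p, so that (a ∷ p)_even = a + z p_odd
  -- and (a ∷ p)_odd = z p_even.
  evenOddP-mulP : ∀ p q →
    evenP (mulP p q) ≋ addP (mulP (evenP p) (evenP q)) (mulP (oddP p) (oddP q)) ×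
    oddP  (mulP p q) ≋ addP (mulP (evenP p) (oddP q)) (mulP (oddP p) (evenP q))
  evenOddP-mulP []      q = ≋-refl , ≋-refl
  evenOddP-mulP (a ∷ p) q = even , odd
    where
    ih : evenP (mulP p q) ≋ addP (mulP (evenP p) (evenP q)) (mulP (oddP p) (oddP q)) ×
         oddP  (mulP p q) ≋ addP (mulP (evenP p) (oddP q)) (mulP (oddP p) (evenP q))
    ih = evenOddP-mulP p q
    Eq Oq Ep Op : List A
    Eq = evenP q ; Oq = oddP q ; Ep = evenP p ; Op = oddP p
    even : evenP (mulP (a ∷ p) q) ≋ addP (mulP (a ∷ Op) Eq) (mulP (0# ∷ Ep) Oq)
    even = ≋-trans (evenP-addP (scaleP a q) (0# ∷ mulP p q))
      (≋-trans (addP-cong (≋-trans (evenP-scaleP a q) (≋-sym (const-mulP a Eq)))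
                          (≋-trans (∷-cong refl (proj₂ ih)) (≋-sym (𝕫-mulP _))))
      (≋-trans (PolynomialSolver.solve 6 (λ c z e o e' o' → c ⊗ e ⊕ z ⊗ (e' ⊗ o ⊕ o' ⊗ e) ⊜ (c ⊕ z ⊗ o') ⊗ e ⊕ (z ⊗ e') ⊗ o)
                        ≋-refl (const a) 𝕫 Eq Oq Ep Op)
      (addP-cong (mulP-cong (≋-sym (∷-as-sum a Op)) ≋-refl) (mulP-cong (𝕫-mulP Ep) ≋-refl))))

    odd : oddP (mulP (a ∷ p) q) ≋ addP (mulP (a ∷ Op) Oq) (mulP (0# ∷ Ep) Eq)
    odd = ≋-trans (oddP-addP (scaleP a q) (0# ∷ mulP p q))
      (≋-trans (addP-cong (≋-trans (oddP-scaleP a q) (≋-sym (const-mulP a Oq)))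
                          (≋-trans (∷-cong refl (proj₁ ih)) (≋-sym (𝕫-mulP _))))
      (≋-trans (PolynomialSolver.solve 6 (λ c z e o e' o' → c ⊗ o ⊕ z ⊗ (e' ⊗ e ⊕ o' ⊗ o) ⊜ (c ⊕ z ⊗ o') ⊗ o ⊕ (z ⊗ e') ⊗ e)
                        ≋-refl (const a) 𝕫 Eq Oq Ep Op)
      (addP-cong (mulP-cong (≋-sym (∷-as-sum a Op)) ≋-refl) (mulP-cong (𝕫-mulP Ep) ≋-refl))))

  evenP-mulP : ∀ p q → evenP (mulP p q) ≋ addP (mulP (evenP p) (evenP q)) (mulP (oddP p) (oddP q))
  evenP-mulP p q = proj₁ (evenOddP-mulP p q)

  oddP-mulP : ∀ p q → oddP (mulP p q) ≋ addP (mulP (evenP p) (oddP q)) (mulP (oddP p) (evenP q))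
  oddP-mulP p q = proj₂ (evenOddP-mulP p q)

  DegreeBelow : List A → ℕ → Set
  DegreeBelow p n = ∀ i → coeff p (n +ℕ i) ≡ 0#

  MonicOfDegree : List A → ℕ → Set
  MonicOfDegree p d = coeff p d ≡ 1# × DegreeBelow p (suc d)

  shiftBy : ℕ → List A → List A
  shiftBy zero    p = p
  shiftBy (suc j) p = 0# ∷ shiftBy j p

  coeff-shiftBy : ∀ j p i → coeff (shiftBy j p) (j +ℕ i) ≡ coeff p i
  coeff-shiftBy zero    p i = refl
  coeff-shiftBy (suc j) p i = coeff-shiftBy j p i

  shiftBy-mulP : ∀ j p a → mulP (shiftBy j p) a ≋ shiftBy j (mulP p a)
  shiftBy-mulP zero    p a = ≋-refl
  shiftBy-mulP (suc j) p a = ≋-trans (addP-cong (scaleP-0 a) ≋-refl) (∷-cong refl (shiftBy-mulP j p a))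

  -- Division with remainder by a monic polynomial a of degree d:
  -- p = q a + r with deg r < d, for deg p < j + d (by induction on j, removing
  -- the top coefficient c of p with c z^j a).
  divMod : ∀ a d → MonicOfDegree a d → ∀ j p → DegreeBelow p (j +ℕ d) →
           Σ (List A) λ q → Σ (List A) λ r → p ≋ addP (mulP q a) r × DegreeBelow r d × DegreeBelow q j
  divMod a d monic zero    p deg-p = [] , p , ≋-refl , deg-p , λ i → refl
  divMod a d monic (suc j) p deg-p with divMod a d monic j p' deg-p'
    where
    c : A
    c = coeff p (j +ℕ d)
    t p' : List A
    t  = shiftBy j (const c)
    p' = addP p (negP (mulP t a))
    coeff-ta : ∀ i → coeff (mulP t a) (j +ℕ i) ≡ (c * coeff a i)
    coeff-ta i = trans (coeff-≡ (shiftBy-mulP j (const c) a) (j +ℕ i)) (trans (coeff-shiftBy j (mulP (const c) a) i)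
                 (trans (coeff-≡ (const-mulP c a) i) (coeff-scaleP c a i)))
    deg-p' : DegreeBelow p' (j +ℕ d)
    deg-p' i = begin
      coeff p' (j +ℕ d +ℕ i)
        ≡⟨ coeff-addP p _ (j +ℕ d +ℕ i) ⟩
      (coeff p (j +ℕ d +ℕ i) + coeff (negP (mulP t a)) (j +ℕ d +ℕ i))
        ≡⟨ cong (_+_ (coeff p (j +ℕ d +ℕ i))) (coeff-negP (mulP t a) (j +ℕ d +ℕ i)) ⟩
      (coeff p (j +ℕ d +ℕ i) + (- coeff (mulP t a) (j +ℕ d +ℕ i)))
        ≡⟨ cong (λ x → coeff p (j +ℕ d +ℕ i) + (- x)) (trans (cong (coeff (mulP t a)) (ℕ.+-assoc j d i)) (coeff-ta (d +ℕ i))) ⟩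
      (coeff p (j +ℕ d +ℕ i) + (- (c * coeff a (d +ℕ i))))
        ≡⟨ top-cancels i ⟩
      0# ∎
      where
      -- at i = 0 the leading coefficient c is cancelled; above it both terms vanish
      top-cancels : ∀ i → (coeff p (j +ℕ d +ℕ i) + (- (c * coeff a (d +ℕ i)))) ≡ 0#
      top-cancels zero rewrite ℕ.+-identityʳ (j +ℕ d) | ℕ.+-identityʳ d | proj₁ monic =
        solve 1 (λ c → c ⊕ ⊝ (c ⊗ Κ (+ 1)) ⊜ Κ (+ 0)) refl c
      top-cancels (suc i) rewrite ℕ.+-suc (j +ℕ d) i | ℕ.+-suc d i | proj₂ monic i | deg-p i | x*0≡0 c =
        trans (cong (_+_ 0#) -0≡0) (+-identityˡ 0#)
  ... | q' , r , p'≋ , deg-r , deg-q' = addP q' t , r , p≋ , deg-r , deg-q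
    where
    c : A
    c = coeff p (j +ℕ d)
    t : List A
    t = shiftBy j (const c)
    p≋ : p ≋ addP (mulP (addP q' t) a) r
    p≋ = ≋-trans (PolynomialSolver.solve 2 (λ p x → p ⊜ (p ⊕ (⊝ x)) ⊕ x) ≋-refl p (mulP t a))
         (≋-trans (addP-cong p'≋ ≋-refl)
                  (PolynomialSolver.solve 4 (λ q t a r → (q ⊗ a ⊕ r) ⊕ t ⊗ a ⊜ (q ⊕ t) ⊗ a ⊕ r) ≋-refl q' t a r))
    deg-q : DegreeBelow (addP q' t) (suc j)
    deg-q i rewrite coeff-addP q' t (suc j +ℕ i) | sym (ℕ.+-suc j i) | deg-q' (suc i) | coeff-shiftBy j (const c) (suc i) =
      +-identityˡ 0#

  ⋆-vanishes : ∀ k f g → (∀ i → i ≤ k → f i ≡ 0#) → (f ⋆ g) k ≡ 0#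
  ⋆-vanishes zero    f g f≡0 = trans (cong (_* g 0) (f≡0 0 z≤n)) (0*x≡0 _)
  ⋆-vanishes (suc k) f g f≡0 =
    trans (cong₂ _+_ (trans (cong (_* g (suc k)) (f≡0 0 z≤n)) (0*x≡0 _))
                     (⋆-vanishes k (λ i → f (suc i)) g (λ i i≤k → f≡0 (suc i) (s≤s i≤k))))
          (+-identityˡ 0#)

  mulP-coeff-vanishes : ∀ k q a d → DegreeBelow a (suc d) → d < k →
                        (∀ i → i < k → coeff q (suc i) ≡ 0#) → coeff (mulP q a) k ≡ 0#
  mulP-coeff-vanishes (suc k) q a d deg-a (s≤s d≤k) q-low = begin
    coeff (mulP q a) (suc k)                                         ≡⟨ coeff-mulP q a (suc k) ⟩
    ((coeff q 0 * coeff a (suc k)) + ((λ i → coeff q (suc i)) ⋆ coeff a) k)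
                                                                      ≡⟨ cong₂ _+_ (trans (cong (coeff q 0 *_) a-top) (x*0≡0 _)) q-rest ⟩
    (0# + 0#)                                                         ≡⟨ +-identityˡ 0# ⟩
    0#                                                                ∎
    where
    a-top : coeff a (suc k) ≡ 0#
    a-top = trans (cong (λ j → coeff a (suc j)) (sym (ℕ.m+[n∸m]≡n d≤k))) (deg-a (k ∸ d))
    q-rest : ((λ i → coeff q (suc i)) ⋆ coeff a) k ≡ 0#
    q-rest = ⋆-vanishes k (λ i → coeff q (suc i)) (coeff a) λ i i≤k → q-low i (s≤s i≤k)

ℤ₄-ring : CommutativeRing _ _
ℤ₄-ring = CommutativeRingLaws.commutativeRing ℤ₄-laws

module Coordinates where
  open CommutativeRing ℤ₄-ring using (+-assoc; +-comm; +-identityˡ; +-identityʳ; -‿inverseˡ;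
    *-assoc; *-comm; *-identityˡ; distribˡ; distribʳ; zeroˡ; zeroʳ)
  open import Algebra.Properties.Ring (CommutativeRing.ring ℤ₄-ring) using (-‿distribˡ-*; -‿distribʳ-*)
  open ≡.≡-Reasoning

  V : ℕ → Set
  V k = Vec Z4 k

  infixl 6 _⊞_
  infixr 7 _⊡_

  _⊞_ : ∀ {k} → V k → V k → V k
  _⊞_ = zipWith _+₄_

  _⊡_ : ∀ {k} → Z4 → V k → V k
  c ⊡ v = map (c *₄_) v

  ⊟_ : ∀ {k} → V k → V k
  ⊟_ = map -₄_

  𝟘 : ∀ k → V k
  𝟘 k = replicate k 0₄

  ⊞-assoc : ∀ {k} (u v w : V k) → (u ⊞ v) ⊞ w ≡ u ⊞ (v ⊞ w)
  ⊞-assoc []      []      []      = refl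
  ⊞-assoc (a ∷ u) (b ∷ v) (c ∷ w) = cong₂ _∷_ (+-assoc a b c) (⊞-assoc u v w)

  ⊞-comm : ∀ {k} (u v : V k) → u ⊞ v ≡ v ⊞ u
  ⊞-comm []      []      = refl
  ⊞-comm (a ∷ u) (b ∷ v) = cong₂ _∷_ (+-comm a b) (⊞-comm u v)

  ⊞-identityˡ : ∀ {k} (v : V k) → 𝟘 k ⊞ v ≡ v
  ⊞-identityˡ []      = refl
  ⊞-identityˡ (a ∷ v) = cong₂ _∷_ (+-identityˡ a) (⊞-identityˡ v)

  ⊞-identityʳ : ∀ {k} (v : V k) → v ⊞ 𝟘 k ≡ v
  ⊞-identityʳ v = trans (⊞-comm v _) (⊞-identityˡ v)

  ⊟-inverseˡ : ∀ {k} (v : V k) → ⊟ v ⊞ v ≡ 𝟘 k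
  ⊟-inverseˡ []      = refl
  ⊟-inverseˡ (a ∷ v) = cong₂ _∷_ (-‿inverseˡ a) (⊟-inverseˡ v)

  ⊟-unique : ∀ {k} (x y : V k) → x ⊞ y ≡ 𝟘 k → x ≡ ⊟ y
  ⊟-unique {k} x y x+y≡0 = begin
    x                 ≡⟨ ⊞-identityʳ x ⟨
    x ⊞ 𝟘 k           ≡⟨ cong (x ⊞_) (trans (⊞-comm y (⊟ y)) (⊟-inverseˡ y)) ⟨
    x ⊞ (y ⊞ ⊟ y)     ≡⟨ ⊞-assoc x y _ ⟨
    (x ⊞ y) ⊞ ⊟ y     ≡⟨ cong (_⊞ ⊟ y) x+y≡0 ⟩
    𝟘 k ⊞ ⊟ y         ≡⟨ ⊞-identityˡ _ ⟩
    ⊟ y               ∎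

  ⊞-interchange : ∀ {k} (a b c d : V k) → (a ⊞ b) ⊞ (c ⊞ d) ≡ (a ⊞ c) ⊞ (b ⊞ d)
  ⊞-interchange a b c d = begin
    (a ⊞ b) ⊞ (c ⊞ d)    ≡⟨ ⊞-assoc a b _ ⟩
    a ⊞ (b ⊞ (c ⊞ d))    ≡⟨ cong (a ⊞_) (⊞-assoc b c d) ⟨
    a ⊞ ((b ⊞ c) ⊞ d)    ≡⟨ cong (λ x → a ⊞ (x ⊞ d)) (⊞-comm b c) ⟩
    a ⊞ ((c ⊞ b) ⊞ d)    ≡⟨ cong (a ⊞_) (⊞-assoc c b d) ⟩
    a ⊞ (c ⊞ (b ⊞ d))    ≡⟨ ⊞-assoc a c _ ⟨
    (a ⊞ c) ⊞ (b ⊞ d)    ∎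

  ⊡-distribˡ : ∀ {k} c (u v : V k) → c ⊡ (u ⊞ v) ≡ c ⊡ u ⊞ c ⊡ v
  ⊡-distribˡ c []      []      = refl
  ⊡-distribˡ c (a ∷ u) (b ∷ v) = cong₂ _∷_ (distribˡ c a b) (⊡-distribˡ c u v)

  ⊡-distribʳ : ∀ {k} c d (v : V k) → (c +₄ d) ⊡ v ≡ c ⊡ v ⊞ d ⊡ v
  ⊡-distribʳ c d []      = refl
  ⊡-distribʳ c d (a ∷ v) = cong₂ _∷_ (distribʳ a c d) (⊡-distribʳ c d v)

  ⊡-assoc : ∀ {k} c d (v : V k) → c ⊡ d ⊡ v ≡ (c *₄ d) ⊡ v
  ⊡-assoc c d []      = refl
  ⊡-assoc c d (a ∷ v) = cong₂ _∷_ (sym (*-assoc c d a)) (⊡-assoc c d v)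

  ⊡-identity : ∀ {k} (v : V k) → 1₄ ⊡ v ≡ v
  ⊡-identity []      = refl
  ⊡-identity (a ∷ v) = cong₂ _∷_ (*-identityˡ a) (⊡-identity v)

  0⊡v : ∀ {k} (v : V k) → 0₄ ⊡ v ≡ 𝟘 k
  0⊡v []      = refl
  0⊡v (a ∷ v) = cong₂ _∷_ (zeroˡ a) (0⊡v v)

  c⊡𝟘 : ∀ {k} c → c ⊡ 𝟘 k ≡ 𝟘 k
  c⊡𝟘 {zero}  c = refl
  c⊡𝟘 {suc k} c = cong₂ _∷_ (zeroʳ c) (c⊡𝟘 c)

  -c⊡v : ∀ {k} c (v : V k) → (-₄ c) ⊡ v ≡ ⊟ (c ⊡ v)
  -c⊡v c []      = refl
  -c⊡v c (a ∷ v) = cong₂ _∷_ (sym (-‿distribˡ-* c a)) (-c⊡v c v)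

  c⊡⊟v : ∀ {k} c (v : V k) → c ⊡ ⊟ v ≡ ⊟ (c ⊡ v)
  c⊡⊟v c []      = refl
  c⊡⊟v c (a ∷ v) = cong₂ _∷_ (sym (-‿distribʳ-* c a)) (c⊡⊟v c v)

module ℤ₄[x] = Polynomials ℤ₄-laws

-- Everything rests on the action  l ▸ a = l(x)·a  of a
-- coefficient list l ∈ ℤ/4[x] on R, computed by Horner's rule from xmul
-- (multiplication by x modulo h); the product of Defs is  a *R b = toList b ▸ a.
module GaloisRing (n : ℕ) (hl : Vec Z4 (suc n)) where
  open Coordinates
  open GR (suc n) hl
  open ℤ₄[x] using (coeff; addP; scaleP; mulP; _≋_; coeff-≡)
  open CommutativeRing ℤ₄-ring using (*-comm; *-identityʳ; +-identityʳ; zeroʳ)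
  open import Algebra.Properties.Ring (CommutativeRing.ring ℤ₄-ring) using (-‿distribˡ-*; -‿distribʳ-*; -‿+-comm)
  open ≡.≡-Reasoning

  m : ℕ
  m = suc n

  pushPop-∷ : ∀ {k} c a (as : V k) → pushPop c (a ∷ as) ≡ (c ∷ proj₁ (pushPop a as) , proj₂ (pushPop a as))
  pushPop-∷ c a as with pushPop a as
  ... | v , t = refl

  pushPop-⊞ : ∀ {k} c d (u v : V k) →
    proj₁ (pushPop (c +₄ d) (u ⊞ v)) ≡ proj₁ (pushPop c u) ⊞ proj₁ (pushPop d v) ×
    proj₂ (pushPop (c +₄ d) (u ⊞ v)) ≡ proj₂ (pushPop c u) +₄ proj₂ (pushPop d v)
  pushPop-⊞ c d []      []      = refl , refl
  pushPop-⊞ c d (a ∷ u) (b ∷ v)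
    rewrite pushPop-∷ (c +₄ d) (a +₄ b) (u ⊞ v) | pushPop-∷ c a u | pushPop-∷ d b v
    = let (shifted , carried) = pushPop-⊞ a b u v in cong ((c +₄ d) ∷_) shifted , carried

  pushPop-⊡ : ∀ {k} e c (u : V k) →
    proj₁ (pushPop (e *₄ c) (e ⊡ u)) ≡ e ⊡ proj₁ (pushPop c u) ×
    proj₂ (pushPop (e *₄ c) (e ⊡ u)) ≡ e *₄ proj₂ (pushPop c u)
  pushPop-⊡ e c []      = refl , refl
  pushPop-⊡ e c (a ∷ u)
    rewrite pushPop-∷ (e *₄ c) (e *₄ a) (e ⊡ u) | pushPop-∷ c a u
    = let (shifted , carried) = pushPop-⊡ e a u in cong ((e *₄ c) ∷_) shifted , carried

  pushPop-toList : ∀ {k} c (u : V k) → (c ∷ toList u) ≡ toList (proj₁ (pushPop c u)) ++ (proj₂ (pushPop c u) ∷ [])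
  pushPop-toList c []      = refl
  pushPop-toList c (a ∷ u) rewrite pushPop-∷ c a u = cong (c ∷_) (pushPop-toList a u)

  shift : R → R
  shift a = proj₁ (pushPop 0₄ a)

  top : R → Z4
  top a = proj₂ (pushPop 0₄ a)

  -- multiplication by x: shift up, and replace the overflowing x^m by -hl
  xmul-shift : ∀ a → xmul a ≡ shift a ⊞ (-₄ top a) ⊡ hl
  xmul-shift a with pushPop 0₄ a
  ... | v , t = go v hl
    where
    go : ∀ {k} (v hs : V k) → zipWith (λ s hi → s +₄ (-₄ (t *₄ hi))) v hs ≡ v ⊞ (-₄ t) ⊡ hs
    go []      []       = refl
    go (a ∷ v) (h ∷ hs) = cong₂ _∷_ (cong (a +₄_) (-‿distribˡ-* t h)) (go v hs)

  xmul-⊞ : ∀ u v → xmul (u ⊞ v) ≡ xmul u ⊞ xmul v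
  xmul-⊞ u v = begin
    xmul (u ⊞ v)                                             ≡⟨ xmul-shift (u ⊞ v) ⟩
    shift (u ⊞ v) ⊞ (-₄ top (u ⊞ v)) ⊡ hl                    ≡⟨ cong₂ (λ s t → s ⊞ (-₄ t) ⊡ hl) (proj₁ split) (proj₂ split) ⟩
    (shift u ⊞ shift v) ⊞ (-₄ (top u +₄ top v)) ⊡ hl         ≡⟨ cong (λ c → (shift u ⊞ shift v) ⊞ c ⊡ hl) (-‿+-comm (top u) (top v)) ⟨
    (shift u ⊞ shift v) ⊞ ((-₄ top u) +₄ (-₄ top v)) ⊡ hl    ≡⟨ cong ((shift u ⊞ shift v) ⊞_) (⊡-distribʳ (-₄ top u) (-₄ top v) hl) ⟩
    (shift u ⊞ shift v) ⊞ ((-₄ top u) ⊡ hl ⊞ (-₄ top v) ⊡ hl) ≡⟨ ⊞-interchange _ _ _ _ ⟩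
    (shift u ⊞ (-₄ top u) ⊡ hl) ⊞ (shift v ⊞ (-₄ top v) ⊡ hl) ≡⟨ cong₂ _⊞_ (xmul-shift u) (xmul-shift v) ⟨
    xmul u ⊞ xmul v                                          ∎
    where
    split : shift (u ⊞ v) ≡ shift u ⊞ shift v × top (u ⊞ v) ≡ top u +₄ top v
    split = pushPop-⊞ 0₄ 0₄ u v

  xmul-⊡ : ∀ e u → xmul (e ⊡ u) ≡ e ⊡ xmul u
  xmul-⊡ e u = begin
    xmul (e ⊡ u)                                    ≡⟨ xmul-shift (e ⊡ u) ⟩
    shift (e ⊡ u) ⊞ (-₄ top (e ⊡ u)) ⊡ hl           ≡⟨ cong₂ (λ s t → s ⊞ (-₄ t) ⊡ hl) (proj₁ split) (proj₂ split) ⟩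
    e ⊡ shift u ⊞ (-₄ (e *₄ top u)) ⊡ hl            ≡⟨ cong (λ c → e ⊡ shift u ⊞ c ⊡ hl) (-‿distribʳ-* e (top u)) ⟩
    e ⊡ shift u ⊞ (e *₄ (-₄ top u)) ⊡ hl            ≡⟨ cong (e ⊡ shift u ⊞_) (⊡-assoc e (-₄ top u) hl) ⟨
    e ⊡ shift u ⊞ e ⊡ (-₄ top u) ⊡ hl               ≡⟨ ⊡-distribˡ e (shift u) ((-₄ top u) ⊡ hl) ⟨
    e ⊡ (shift u ⊞ (-₄ top u) ⊡ hl)                 ≡⟨ cong (e ⊡_) (xmul-shift u) ⟨
    e ⊡ xmul u                                      ∎
    where
    split : proj₁ (pushPop 0₄ (e ⊡ u)) ≡ e ⊡ shift u × proj₂ (pushPop 0₄ (e ⊡ u)) ≡ e *₄ top u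
    split = subst (λ c → proj₁ (pushPop c (e ⊡ u)) ≡ e ⊡ shift u × proj₂ (pushPop c (e ⊡ u)) ≡ e *₄ top u)
                    (zeroʳ e) (pushPop-⊡ e 0₄ u)

  xmul-𝟘 : xmul (𝟘 m) ≡ 𝟘 m
  xmul-𝟘 = trans (cong xmul (sym (0⊡v (𝟘 m)))) (trans (xmul-⊡ 0₄ (𝟘 m)) (0⊡v _))

  -- the action of a coefficient list on R: l ▸ a = l(x) · a
  infixr 7 _▸_
  _▸_ : List Z4 → R → R
  l ▸ a = foldr (λ bk acc → bk ⊡ a ⊞ xmul acc) 0R l

  xPow : ℕ → R → R
  xPow zero    v = v
  xPow (suc k) v = xmul (xPow k v)

  ▸-⊞ : ∀ l u v → l ▸ (u ⊞ v) ≡ l ▸ u ⊞ l ▸ v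
  ▸-⊞ []      u v = sym (⊞-identityˡ (𝟘 m))
  ▸-⊞ (b ∷ l) u v = trans (cong₂ _⊞_ (⊡-distribˡ b u v) (trans (cong xmul (▸-⊞ l u v)) (xmul-⊞ (l ▸ u) (l ▸ v))))
                           (⊞-interchange _ _ _ _)

  ▸-⊡ : ∀ l e u → l ▸ e ⊡ u ≡ e ⊡ l ▸ u
  ▸-⊡ []      e u = sym (c⊡𝟘 e)
  ▸-⊡ (b ∷ l) e u = trans (cong₂ _⊞_ (trans (⊡-assoc b e u) (trans (cong (_⊡ u) (*-comm b e)) (sym (⊡-assoc e b u))))
                                     (trans (cong xmul (▸-⊡ l e u)) (xmul-⊡ e (l ▸ u))))
                           (sym (⊡-distribˡ e _ _))

  ▸-𝟘 : ∀ l → l ▸ 𝟘 m ≡ 𝟘 m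
  ▸-𝟘 l = trans (cong (l ▸_) (sym (0⊡v (𝟘 m)))) (trans (▸-⊡ l 0₄ (𝟘 m)) (0⊡v _))

  ▸-xmul : ∀ l a → l ▸ xmul a ≡ xmul (l ▸ a)
  ▸-xmul []      a = sym xmul-𝟘
  ▸-xmul (b ∷ l) a = trans (cong₂ _⊞_ (sym (xmul-⊡ b a)) (cong xmul (▸-xmul l a))) (sym (xmul-⊞ (b ⊡ a) (xmul (l ▸ a))))

  addP-▸ : ∀ l l' a → addP l l' ▸ a ≡ l ▸ a ⊞ l' ▸ a
  addP-▸ []      l'       a = sym (⊞-identityˡ _)
  addP-▸ (b ∷ l) []       a = sym (⊞-identityʳ _)
  addP-▸ (b ∷ l) (c ∷ l') a = trans (cong₂ _⊞_ (⊡-distribʳ b c a) (trans (cong xmul (addP-▸ l l' a)) (xmul-⊞ (l ▸ a) (l' ▸ a))))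
                                     (⊞-interchange _ _ _ _)

  scaleP-▸ : ∀ e l a → scaleP e l ▸ a ≡ e ⊡ l ▸ a
  scaleP-▸ e []      a = sym (c⊡𝟘 e)
  scaleP-▸ e (b ∷ l) a = trans (cong₂ _⊞_ (sym (⊡-assoc e b a)) (trans (cong xmul (scaleP-▸ e l a)) (xmul-⊡ e (l ▸ a))))
                               (sym (⊡-distribˡ e _ _))

  0∷-▸ : ∀ l c → (0₄ ∷ l) ▸ c ≡ xmul (l ▸ c)
  0∷-▸ l c = trans (cong (_⊞ xmul (l ▸ c)) (0⊡v c)) (⊞-identityˡ _)

  ▸-comm : ∀ l l' c → l' ▸ l ▸ c ≡ l ▸ l' ▸ c
  ▸-comm []      l' c = ▸-𝟘 l'
  ▸-comm (b ∷ l) l' c = trans (▸-⊞ l' (b ⊡ c) (xmul (l ▸ c)))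
    (cong₂ _⊞_ (▸-⊡ l' b c) (trans (▸-xmul l' (l ▸ c)) (cong xmul (▸-comm l l' c))))

  mulP-▸ : ∀ p q c → mulP p q ▸ c ≡ p ▸ q ▸ c
  mulP-▸ []      q c = refl
  mulP-▸ (a ∷ p) q c = trans (addP-▸ (scaleP a q) (0₄ ∷ mulP p q) c)
    (cong₂ _⊞_ (scaleP-▸ a q c) (trans (0∷-▸ (mulP p q) c) (cong xmul (mulP-▸ p q c))))

  xPow-▸ : ∀ k l c → xPow k (l ▸ c) ≡ l ▸ xPow k c
  xPow-▸ zero    l c = refl
  xPow-▸ (suc k) l c = trans (cong xmul (xPow-▸ k l c)) (sym (▸-xmul l (xPow k c)))

  xPow-⊡ : ∀ k e v → xPow k (e ⊡ v) ≡ e ⊡ xPow k v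
  xPow-⊡ zero    e v = refl
  xPow-⊡ (suc k) e v = trans (cong xmul (xPow-⊡ k e v)) (xmul-⊡ e (xPow k v))

  ++-▸ : ∀ l l' c → (l ++ l') ▸ c ≡ l ▸ c ⊞ xPow (length l) (l' ▸ c)
  ++-▸ []      l' c = sym (⊞-identityˡ _)
  ++-▸ (b ∷ l) l' c = trans (cong (b ⊡ c ⊞_) (trans (cong xmul (++-▸ l l' c)) (xmul-⊞ (l ▸ c) (xPow (length l) (l' ▸ c)))))
                             (sym (⊞-assoc _ _ _))

  zero-▸ : ∀ p c → (∀ k → coeff p k ≡ 0₄) → p ▸ c ≡ 𝟘 m
  zero-▸ []      c p≡0 = refl
  zero-▸ (a ∷ p) c p≡0 rewrite p≡0 0 = trans (0∷-▸ p c) (trans (cong xmul (zero-▸ p c (λ k → p≡0 (suc k)))) xmul-𝟘)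

  ▸-cong : ∀ {p q} c → p ≋ q → p ▸ c ≡ q ▸ c
  ▸-cong {p} {q} c p≋q = go p q (coeff-≡ p≋q)
    where
    go : ∀ p q → (∀ k → coeff p k ≡ coeff q k) → p ▸ c ≡ q ▸ c
    go []      q       e = sym (zero-▸ q c (λ k → sym (e k)))
    go (a ∷ p) []      e = zero-▸ (a ∷ p) c e
    go (a ∷ p) (b ∷ q) e = cong₂ (λ x y → x ⊡ c ⊞ xmul y) (e 0) (go p q (λ k → e (suc k)))

  padTo : (k : ℕ) → List Z4 → V k
  padTo zero    l       = []
  padTo (suc k) []      = 0₄ ∷ padTo k []
  padTo (suc k) (b ∷ l) = b ∷ padTo k l

  padTo-[] : ∀ k → padTo k [] ≡ 𝟘 k
  padTo-[] zero    = refl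
  padTo-[] (suc k) = cong (0₄ ∷_) (padTo-[] k)

  padTo-toList : ∀ {k} (v : V k) → padTo k (toList v) ≡ v
  padTo-toList []      = refl
  padTo-toList (a ∷ v) = cong (a ∷_) (padTo-toList v)

  pushPop-padTo : ∀ k c l → length l ≤ k → pushPop c (padTo (suc k) l) ≡ (c ∷ padTo k l , 0₄)
  pushPop-padTo zero    c []      _         = refl
  pushPop-padTo (suc k) c []      _         = trans (pushPop-∷ c 0₄ (padTo (suc k) []))
    (cong (λ p → (c ∷ proj₁ p , proj₂ p)) (pushPop-padTo k 0₄ [] z≤n))
  pushPop-padTo (suc k) c (b ∷ l) (s≤s l≤k) = trans (pushPop-∷ c b (padTo (suc k) l))
    (cong (λ p → (c ∷ proj₁ p , proj₂ p)) (pushPop-padTo k b l l≤k))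

  xmul-padTo : ∀ l → length l ≤ n → xmul (padTo m l) ≡ padTo m (0₄ ∷ l)
  xmul-padTo l l≤n = trans (xmul-shift (padTo m l))
    (trans (cong₂ (λ s t → s ⊞ (-₄ t) ⊡ hl) (cong proj₁ (pushPop-padTo n 0₄ l l≤n)) (cong proj₂ (pushPop-padTo n 0₄ l l≤n)))
           (trans (cong ((0₄ ∷ padTo n l) ⊞_) (0⊡v hl)) (⊞-identityʳ _)))

  ▸1-padTo : ∀ l → length l ≤ m → l ▸ 1R ≡ padTo m l
  ▸1-padTo []      _         = sym (padTo-[] m)
  ▸1-padTo (b ∷ l) (s≤s l≤n) =
    trans (cong (b ⊡ 1R ⊞_) (trans (cong xmul (▸1-padTo l (ℕ.m≤n⇒m≤1+n l≤n))) (xmul-padTo l l≤n)))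
          (cong₂ _∷_ (trans (cong (_+₄ 0₄) (*-identityʳ b)) (+-identityʳ b))
                     (trans (cong (_⊞ padTo n l) (c⊡𝟘 b)) (⊞-identityˡ _)))

  toList-▸1 : ∀ v → toList v ▸ 1R ≡ v
  toList-▸1 v = trans (▸1-padTo (toList v) (ℕ.≤-reflexive (Vec.length-toList v))) (padTo-toList v)

  [1]▸ : ∀ a → (1₄ ∷ []) ▸ a ≡ a
  [1]▸ a = trans (cong₂ _⊞_ (⊡-identity a) xmul-𝟘) (⊞-identityʳ a)

  zeros : ℕ → List Z4
  zeros zero    = []
  zeros (suc k) = 0₄ ∷ zeros k

  xPow-zeros : ∀ k l c → xPow k (l ▸ c) ≡ (zeros k ++ l) ▸ c
  xPow-zeros zero    l c = refl
  xPow-zeros (suc k) l c = trans (cong xmul (xPow-zeros k l c)) (sym (0∷-▸ (zeros k ++ l) c))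

  -- x^n is the last basis vector e_n = (0,…,0,1); xmul pushes it over the top
  xⁿ : padTo m (zeros n ++ (1₄ ∷ [])) ≡ xPow n 1R
  xⁿ = sym (trans (cong (xPow n) (sym ([1]▸ 1R)))
           (trans (xPow-zeros n (1₄ ∷ []) 1R) (▸1-padTo (zeros n ++ (1₄ ∷ [])) (ℕ.≤-reflexive (length-zeros n)))))
    where
    length-zeros : ∀ k → length (zeros k ++ (1₄ ∷ [])) ≡ suc k
    length-zeros zero    = refl
    length-zeros (suc k) = cong suc (length-zeros k)

  pushPop-eₙ : ∀ k c → pushPop c (padTo (suc k) (zeros k ++ (1₄ ∷ []))) ≡ (c ∷ 𝟘 k , 1₄)
  pushPop-eₙ zero    c = refl
  pushPop-eₙ (suc k) c = trans (pushPop-∷ c 0₄ (padTo (suc k) (zeros k ++ (1₄ ∷ []))))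
                               (cong (λ p → (c ∷ proj₁ p , proj₂ p)) (pushPop-eₙ k 0₄))

  xᵐ≡-hl : xPow m 1R ≡ ⊟ hl
  xᵐ≡-hl = begin
    xmul (xPow n 1R)                      ≡⟨ cong xmul xⁿ ⟨
    xmul eₙ                               ≡⟨ xmul-shift eₙ ⟩
    shift eₙ ⊞ (-₄ top eₙ) ⊡ hl           ≡⟨ cong₂ (λ s t → s ⊞ (-₄ t) ⊡ hl) (cong proj₁ (pushPop-eₙ n 0₄)) (cong proj₂ (pushPop-eₙ n 0₄)) ⟩
    𝟘 m ⊞ (-₄ 1₄) ⊡ hl                    ≡⟨ ⊞-identityˡ _ ⟩
    (-₄ 1₄) ⊡ hl                          ≡⟨ -c⊡v 1₄ hl ⟩
    ⊟ (1₄ ⊡ hl)                           ≡⟨ cong ⊟_ (⊡-identity hl) ⟩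
    ⊟ hl                                  ∎
    where
    eₙ : R
    eₙ = padTo m (zeros n ++ (1₄ ∷ []))

  h▸≡0 : ∀ a → xPow m a ⊞ toList hl ▸ a ≡ 𝟘 m
  h▸≡0 a = begin
    xPow m a ⊞ toList hl ▸ a                                      ≡⟨ cong₂ (λ x y → xPow m x ⊞ toList hl ▸ y) (toList-▸1 a) (toList-▸1 a) ⟨
    xPow m (toList a ▸ 1R) ⊞ toList hl ▸ toList a ▸ 1R            ≡⟨ cong₂ _⊞_ (xPow-▸ m (toList a) 1R) (▸-comm (toList a) (toList hl) 1R) ⟩
    toList a ▸ xPow m 1R ⊞ toList a ▸ toList hl ▸ 1R              ≡⟨ cong₂ (λ x y → toList a ▸ x ⊞ toList a ▸ y) xᵐ≡-hl (toList-▸1 hl) ⟩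
    toList a ▸ ⊟ hl ⊞ toList a ▸ hl                               ≡⟨ ▸-⊞ (toList a) (⊟ hl) hl ⟨
    toList a ▸ (⊟ hl ⊞ hl)                                        ≡⟨ cong (toList a ▸_) (⊟-inverseˡ hl) ⟩
    toList a ▸ 𝟘 m                                                ≡⟨ ▸-𝟘 (toList a) ⟩
    𝟘 m                                                           ∎

  toList-⊞ : ∀ {k} (u v : V k) → toList (u ⊞ v) ≡ addP (toList u) (toList v)
  toList-⊞ []      []      = refl
  toList-⊞ (a ∷ u) (b ∷ v) = cong ((a +₄ b) ∷_) (toList-⊞ u v)

  toList-⊡ : ∀ {k} e (v : V k) → toList (e ⊡ v) ≡ scaleP e (toList v)
  toList-⊡ e []      = refl
  toList-⊡ e (a ∷ v) = cong ((e *₄ a) ∷_) (toList-⊡ e v)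

  toList-𝟘 : ∀ k i → coeff (toList (𝟘 k)) i ≡ 0₄
  toList-𝟘 zero    i       = refl
  toList-𝟘 (suc k) zero    = refl
  toList-𝟘 (suc k) (suc i) = toList-𝟘 k i

  toList-xmul-▸ : ∀ a w → toList (xmul w) ▸ a ≡ xmul (toList w ▸ a)
  toList-xmul-▸ a w = begin
    toList (xmul w) ▸ a                                           ≡⟨ cong (λ z → toList z ▸ a) (xmul-shift w) ⟩
    toList (shift w ⊞ (-₄ t) ⊡ hl) ▸ a                            ≡⟨ cong (_▸ a) (trans (toList-⊞ (shift w) _) (cong (addP (toList (shift w))) (toList-⊡ (-₄ t) hl))) ⟩
    addP (toList (shift w)) (scaleP (-₄ t) (toList hl)) ▸ a       ≡⟨ addP-▸ (toList (shift w)) _ a ⟩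
    toList (shift w) ▸ a ⊞ scaleP (-₄ t) (toList hl) ▸ a          ≡⟨ cong (toList (shift w) ▸ a ⊞_) (scaleP-▸ (-₄ t) (toList hl) a) ⟩
    toList (shift w) ▸ a ⊞ (-₄ t) ⊡ toList hl ▸ a                 ≡⟨ cong (toList (shift w) ▸ a ⊞_) (trans (-c⊡v t _) (sym (c⊡⊟v t _))) ⟩
    toList (shift w) ▸ a ⊞ t ⊡ ⊟ (toList hl ▸ a)                  ≡⟨ cong (λ z → toList (shift w) ▸ a ⊞ t ⊡ z) (⊟-unique (xPow m a) _ (h▸≡0 a)) ⟨
    toList (shift w) ▸ a ⊞ t ⊡ xPow m a                           ≡⟨ cong (toList (shift w) ▸ a ⊞_) (xPow-⊡ m t a) ⟨
    toList (shift w) ▸ a ⊞ xPow m (t ⊡ a)                         ≡⟨ cong (λ k → toList (shift w) ▸ a ⊞ xPow k (t ⊡ a)) (Vec.length-toList (shift w)) ⟨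
    toList (shift w) ▸ a ⊞ xPow (length (toList (shift w))) (t ⊡ a) ≡⟨ cong (λ z → toList (shift w) ▸ a ⊞ xPow (length (toList (shift w))) z) (t▸a) ⟨
    toList (shift w) ▸ a ⊞ xPow (length (toList (shift w))) ((t ∷ []) ▸ a) ≡⟨ ++-▸ (toList (shift w)) (t ∷ []) a ⟨
    (toList (shift w) ++ (t ∷ [])) ▸ a                            ≡⟨ cong (_▸ a) (pushPop-toList 0₄ w) ⟨
    (0₄ ∷ toList w) ▸ a                                           ≡⟨ 0∷-▸ (toList w) a ⟩
    xmul (toList w ▸ a)                                           ∎
    where
    t : Z4
    t = top w
    t▸a : (t ∷ []) ▸ a ≡ t ⊡ a
    t▸a = trans (cong (t ⊡ a ⊞_) xmul-𝟘) (⊞-identityʳ _)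

  toList-▸-▸ : ∀ a b cs → toList (cs ▸ b) ▸ a ≡ cs ▸ toList b ▸ a
  toList-▸-▸ a b []       = zero-▸ (toList (𝟘 m)) a (toList-𝟘 m)
  toList-▸-▸ a b (c ∷ cs) = begin
    toList (c ⊡ b ⊞ xmul (cs ▸ b)) ▸ a                          ≡⟨ cong (_▸ a) (trans (toList-⊞ (c ⊡ b) _) (cong (λ z → addP z (toList (xmul (cs ▸ b)))) (toList-⊡ c b))) ⟩
    addP (scaleP c (toList b)) (toList (xmul (cs ▸ b))) ▸ a     ≡⟨ addP-▸ (scaleP c (toList b)) (toList (xmul (cs ▸ b))) a ⟩
    scaleP c (toList b) ▸ a ⊞ toList (xmul (cs ▸ b)) ▸ a        ≡⟨ cong₂ _⊞_ (scaleP-▸ c (toList b) a) (toList-xmul-▸ a (cs ▸ b)) ⟩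
    c ⊡ toList b ▸ a ⊞ xmul (toList (cs ▸ b) ▸ a)               ≡⟨ cong (λ z → c ⊡ toList b ▸ a ⊞ xmul z) (toList-▸-▸ a b cs) ⟩
    c ⊡ toList b ▸ a ⊞ xmul (cs ▸ toList b ▸ a)                 ∎

  *R-comm : ∀ a b → a *R b ≡ b *R a
  *R-comm a b = begin
    toList b ▸ a                      ≡⟨ cong (toList b ▸_) (toList-▸1 a) ⟨
    toList b ▸ toList a ▸ 1R          ≡⟨ ▸-comm (toList a) (toList b) 1R ⟩
    toList a ▸ toList b ▸ 1R          ≡⟨ cong (toList a ▸_) (toList-▸1 b) ⟩
    toList a ▸ b                      ∎

  *R-assoc : ∀ a b c → (a *R b) *R c ≡ a *R (b *R c)
  *R-assoc a b c = sym (toList-▸-▸ a b (toList c))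

  R-laws : CommutativeRingLaws _≡_ _+R_ _*R_ -R_ 0R 1R
  R-laws = record
    { isEquivalence = ≡.isEquivalence
    ; +-cong = cong₂ _+R_ ; *-cong = cong₂ _*R_ ; -‿cong = cong -R_
    ; +-assoc = ⊞-assoc ; +-comm = ⊞-comm ; +-identityˡ = ⊞-identityˡ ; -‿inverseˡ = ⊟-inverseˡ
    ; *-assoc = *R-assoc ; *-comm = *R-comm ; *-identityˡ = toList-▸1
    ; distribʳ = λ a b c → ▸-⊞ (toList a) b c }

  R-ring : CommutativeRing _ _
  R-ring = CommutativeRingLaws.commutativeRing R-laws

  eval : List Z4 → R
  eval p = p ▸ 1R

  ▸≡eval-* : ∀ p a → p ▸ a ≡ eval p *R a
  ▸≡eval-* p a = sym (trans (▸-comm p (toList a) 1R) (cong (p ▸_) (toList-▸1 a)))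

  eval-addP : ∀ p q → eval (addP p q) ≡ eval p +R eval q
  eval-addP p q = addP-▸ p q 1R

  eval-mulP : ∀ p q → eval (mulP p q) ≡ eval p *R eval q
  eval-mulP p q = trans (mulP-▸ p q 1R) (▸≡eval-* p (eval q))

  eval-1 : eval ℤ₄[x].1P ≡ 1R
  eval-1 = [1]▸ 1R

  eval-h : eval (hPoly hl) ≡ 0R
  eval-h = begin
    (toList hl ++ (1₄ ∷ [])) ▸ 1R                                   ≡⟨ ++-▸ (toList hl) (1₄ ∷ []) 1R ⟩
    toList hl ▸ 1R ⊞ xPow (length (toList hl)) ((1₄ ∷ []) ▸ 1R)      ≡⟨ cong₂ (λ x k → x ⊞ xPow k ((1₄ ∷ []) ▸ 1R)) (toList-▸1 hl) (Vec.length-toList hl) ⟩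
    hl ⊞ xPow m ((1₄ ∷ []) ▸ 1R)                                    ≡⟨ cong (λ z → hl ⊞ xPow m z) eval-1 ⟩
    hl ⊞ xPow m 1R                                                  ≡⟨ cong (hl ⊞_) xᵐ≡-hl ⟩
    hl ⊞ ⊟ hl                                                       ≡⟨ ⊞-comm hl _ ⟩
    ⊟ hl ⊞ hl                                                       ≡⟨ ⊟-inverseˡ hl ⟩
    0R                                                              ∎

  eval-cong : ∀ {p q} → p ≋ q → eval p ≡ eval q
  eval-cong = ▸-cong 1R

  2R*v : ∀ v → 2R *R v ≡ 2₄ ⊡ v
  2R*v v = trans (▸-⊡ (toList v) 2₄ 1R) (cong (2₄ ⊡_) (toList-▸1 v))

  eval-scaleP : ∀ e p → eval (scaleP e p) ≡ e ⊡ eval p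
  eval-scaleP e p = scaleP-▸ e p 1R

module 𝔽₂[x] = Polynomials 𝔽₂-laws

-- By strong induction on the degree
-- d of w: divide hb by w; the remainder is nonzero (hb is irreducible), has
-- smaller degree, and an inverse of it yields one of w (Euclid's algorithm).
module InverseModulo (m : ℕ) (hb : List F2) (irreducible : Irreducible₂ hb)
                     (lead : 𝔽₂[x].coeff hb m ≡ 1₂) (deg-hb : 𝔽₂[x].DegreeBelow hb (suc m)) where
  open 𝔽₂[x]
  open PolynomialSolver using (solve; _⊜_; _⊕_; _⊗_; ⊝_)

  InvertibleMod : List F2 → Set
  InvertibleMod w = Σ (List F2) λ s → Σ (List F2) λ c → mulP s w ≋ addP 1P (mulP c hb)

  1₂≢0₂ : ¬ (1₂ ≡ 0₂)
  1₂≢0₂ ()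

  nonzero⇒1 : ∀ (x : F2) → ¬ (x ≡ 0₂) → x ≡ 1₂
  nonzero⇒1 zero       x≢0 = ⊥-elim (x≢0 refl)
  nonzero⇒1 (suc zero) x≢0 = refl

  zeroOrMonic : ∀ n p → DegreeBelow p n → p ≋ [] ⊎ Σ ℕ λ d → d < n × MonicOfDegree p d
  zeroOrMonic zero    p deg-p = inj₁ (coeffwise deg-p)
  zeroOrMonic (suc n) p deg-p with coeff p n ≟ 0₂
  ... | no  top≢0 = inj₂ (n , ℕ.≤-refl , nonzero⇒1 _ top≢0 , deg-p)
  ... | yes top≡0 with zeroOrMonic n p lower
    where
    lower : DegreeBelow p n
    lower zero    rewrite ℕ.+-identityʳ n = top≡0
    lower (suc i) rewrite ℕ.+-suc n i      = deg-p i
  ...   | inj₁ p≋0               = inj₁ p≋0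
  ...   | inj₂ (d , d<n , monic) = inj₂ (d , ℕ.m≤n⇒m≤1+n d<n , monic)

  nonConstantOrLow : ∀ k q → P2.NonConstant q ⊎ (∀ i → i < k → coeff q (suc i) ≡ 0₂)
  nonConstantOrLow zero    q = inj₂ λ i ()
  nonConstantOrLow (suc k) q with nonConstantOrLow k q | coeff q (suc k) ≟ 0₂
  ... | inj₁ nonConstant | _       = inj₁ nonConstant
  ... | inj₂ _           | no  q≢0 = inj₁ (suc k , s≤s z≤n , q≢0)
  ... | inj₂ low         | yes q≡0 = inj₂ λ i i<1+k → case i<1+k
    where
    case : ∀ {i} → i < suc k → coeff q (suc i) ≡ 0₂
    case i<1+k with ℕ.m<1+n⇒m<n∨m≡n i<1+k
    ... | inj₁ i<k  = low _ i<k
    ... | inj₂ refl = q≡0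

  -- hb has no monic factor a of degree 1 ≤ deg a < m: the cofactor q would be
  -- non-constant (contradicting irreducibility) or constant (then hb = q a has
  -- no term in z^m)
  noFactor : ∀ q a d → MonicOfDegree a (suc d) → suc d < m → ¬ (hb ≋ mulP q a)
  noFactor q a d (lead-a , deg-a) d<m hb≋qa with nonConstantOrLow m q
  ... | inj₁ q-nonConstant = irreducible (q , a , q-nonConstant , a-nonConstant , coeff-≡ hb≋qa)
    where
    a-nonConstant : P2.NonConstant a
    a-nonConstant = suc d , s≤s z≤n , λ a≡0 → 1₂≢0₂ (trans (sym lead-a) a≡0)
  ... | inj₂ q-constant = 1₂≢0₂ (trans (sym lead) (trans (coeff-≡ hb≋qa m)
                                   (mulP-coeff-vanishes m q a (suc d) deg-a d<m q-constant)))

  monic-invertible : ∀ d → d < m → ∀ a → MonicOfDegree a d → InvertibleMod a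
  monic-invertible = <-rec (λ d → d < m → ∀ a → MonicOfDegree a d → InvertibleMod a) step
    where
    step : ∀ d → (∀ {e} → e < d → e < m → ∀ a → MonicOfDegree a e → InvertibleMod a) →
           d < m → ∀ a → MonicOfDegree a d → InvertibleMod a
    step zero    _   _   a (lead-a , deg-a) =
      1P , [] , ≋-trans (mulP-identityˡ a) (coeffwise λ { zero → lead-a ; (suc i) → deg-a i })
    step (suc d) rec d<m a monic-a with divMod a (suc d) monic-a (suc m ∸ suc d) hb deg-hb'
      where
      deg-hb' : DegreeBelow hb ((suc m ∸ suc d) +ℕ suc d)
      deg-hb' = subst (DegreeBelow hb) (sym (ℕ.m∸n+n≡m (ℕ.m≤n⇒m≤1+n (ℕ.<⇒≤ d<m)))) deg-hb
    ... | q , r , hb≋qa+r , deg-r , _ with zeroOrMonic (suc d) r deg-r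
    ...   | inj₁ r≋0 = ⊥-elim (noFactor q a d monic-a d<m
                                 (≋-trans hb≋qa+r (≋-trans (addP-cong ≋-refl r≋0) (addP-identityʳ _))))
    ...   | inj₂ (e , e<1+d , monic-r) with rec e<1+d (ℕ.<-trans e<1+d d<m) r monic-r
    ...     | s , c , sr≋1+ch = negP (mulP s q) , addP c (negP s) , inverse
      where
      -- s r = 1 + c hb and r = hb - q a give (-s q) a = 1 + (c - s) hb
      inverse : mulP (negP (mulP s q)) a ≋ addP 1P (mulP (addP c (negP s)) hb)
      inverse = ≋-trans (solve 4 (λ s q a r → (⊝ (s ⊗ q)) ⊗ a ⊜ s ⊗ r ⊕ (⊝ s) ⊗ (q ⊗ a ⊕ r)) ≋-refl s q a r)
        (≋-trans (addP-cong sr≋1+ch (mulP-cong {negP s} ≋-refl (≋-sym hb≋qa+r)))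
        (solve 4 (λ o c s h → (o ⊕ c ⊗ h) ⊕ (⊝ s) ⊗ h ⊜ o ⊕ (c ⊕ (⊝ s)) ⊗ h) ≋-refl 1P c s hb))

  invertible : ∀ w → DegreeBelow w m → ¬ (w ≋ []) → InvertibleMod w
  invertible w deg-w w≢0 with zeroOrMonic m w deg-w
  ... | inj₁ w≋0               = ⊥-elim (w≢0 w≋0)
  ... | inj₂ (d , d<m , monic) = monic-invertible d d<m w monic

module Reduction where
  open ≡.≡-Reasoning
  red-+ : ∀ a b → red (a +₄ b) ≡ (red a +₂ red b)
  red-+ = toWitness {a? = all? λ a → all? λ b → red (a +₄ b) ≟ (red a +₂ red b)} tt

  red-* : ∀ a b → red (a *₄ b) ≡ (red a *₂ red b)
  red-* = toWitness {a? = all? λ a → all? λ b → red (a *₄ b) ≟ (red a *₂ red b)} tt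

  red-- : ∀ a → red (-₄ a) ≡ (-₂ red a)
  red-- = toWitness {a? = all? λ a → red (-₄ a) ≟ (-₂ red a)} tt

  lift : F2 → Z4
  lift zero       = 0₄
  lift (suc zero) = 1₄

  red-lift : ∀ x → red (lift x) ≡ x
  red-lift zero       = refl
  red-lift (suc zero) = refl

  -- a ↦ a/2 on the ideal 2ℤ/4
  halve : Z4 → Z4
  halve (suc (suc zero)) = 1₄
  halve _                = 0₄

  twice-halve : ∀ a → red a ≡ 0₂ → a ≡ (2₄ *₄ halve a)
  twice-halve zero                      _ = refl
  twice-halve (suc zero)                ()
  twice-halve (suc (suc zero))          _ = refl
  twice-halve (suc (suc (suc zero)))    ()

  redP : List Z4 → List F2
  redP = List.map red

  coeff-redP : ∀ p k → 𝔽₂[x].coeff (redP p) k ≡ red (ℤ₄[x].coeff p k)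
  coeff-redP []      k       = refl
  coeff-redP (a ∷ p) zero    = refl
  coeff-redP (a ∷ p) (suc k) = coeff-redP p k

  red-⋆ : ∀ f g k → red ((f ℤ₄[x].⋆ g) k) ≡ ((λ i → red (f i)) 𝔽₂[x].⋆ (λ i → red (g i))) k
  red-⋆ f g zero    = red-* (f 0) (g 0)
  red-⋆ f g (suc k) = trans (red-+ (f 0 *₄ g (suc k)) ((ℤ₄[x]._⋆_ (λ i → f (suc i)) g) k))
                            (cong₂ _+₂_ (red-* (f 0) (g (suc k))) (red-⋆ (λ i → f (suc i)) g k))

  redP-addP : ∀ p q → redP (ℤ₄[x].addP p q) 𝔽₂[x].≋ 𝔽₂[x].addP (redP p) (redP q)
  redP-addP p q = 𝔽₂[x].coeffwise λ k → begin
    𝔽₂[x].coeff (redP (ℤ₄[x].addP p q)) k                   ≡⟨ coeff-redP (ℤ₄[x].addP p q) k ⟩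
    red (ℤ₄[x].coeff (ℤ₄[x].addP p q) k)                     ≡⟨ cong red (ℤ₄[x].coeff-addP p q k) ⟩
    red (ℤ₄[x].coeff p k +₄ ℤ₄[x].coeff q k)                 ≡⟨ red-+ (ℤ₄[x].coeff p k) (ℤ₄[x].coeff q k) ⟩
    red (ℤ₄[x].coeff p k) +₂ red (ℤ₄[x].coeff q k)           ≡⟨ cong₂ _+₂_ (coeff-redP p k) (coeff-redP q k) ⟨
    𝔽₂[x].coeff (redP p) k +₂ 𝔽₂[x].coeff (redP q) k         ≡⟨ 𝔽₂[x].coeff-addP (redP p) (redP q) k ⟨
    𝔽₂[x].coeff (𝔽₂[x].addP (redP p) (redP q)) k             ∎

  redP-negP : ∀ p → redP (ℤ₄[x].negP p) 𝔽₂[x].≋ 𝔽₂[x].negP (redP p)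
  redP-negP p = 𝔽₂[x].coeffwise λ k → begin
    𝔽₂[x].coeff (redP (ℤ₄[x].negP p)) k                     ≡⟨ coeff-redP (ℤ₄[x].negP p) k ⟩
    red (ℤ₄[x].coeff (ℤ₄[x].negP p) k)                       ≡⟨ cong red (ℤ₄[x].coeff-negP p k) ⟩
    red (-₄ ℤ₄[x].coeff p k)                                 ≡⟨ red-- (ℤ₄[x].coeff p k) ⟩
    -₂ red (ℤ₄[x].coeff p k)                                 ≡⟨ cong -₂_ (coeff-redP p k) ⟨
    -₂ 𝔽₂[x].coeff (redP p) k                                ≡⟨ 𝔽₂[x].coeff-negP (redP p) k ⟨
    𝔽₂[x].coeff (𝔽₂[x].negP (redP p)) k                      ∎

  redP-mulP : ∀ p q → redP (ℤ₄[x].mulP p q) 𝔽₂[x].≋ 𝔽₂[x].mulP (redP p) (redP q)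
  redP-mulP p q = 𝔽₂[x].coeffwise λ k → begin
    𝔽₂[x].coeff (redP (ℤ₄[x].mulP p q)) k                                   ≡⟨ coeff-redP (ℤ₄[x].mulP p q) k ⟩
    red (ℤ₄[x].coeff (ℤ₄[x].mulP p q) k)                                     ≡⟨ cong red (ℤ₄[x].coeff-mulP p q k) ⟩
    red ((ℤ₄[x].coeff p ℤ₄[x].⋆ ℤ₄[x].coeff q) k)                            ≡⟨ red-⋆ (ℤ₄[x].coeff p) (ℤ₄[x].coeff q) k ⟩
    ((λ i → red (ℤ₄[x].coeff p i)) 𝔽₂[x].⋆ (λ i → red (ℤ₄[x].coeff q i))) k  ≡⟨ 𝔽₂[x].⋆-cong (coeff-redP p) (coeff-redP q) k ⟨
    (𝔽₂[x].coeff (redP p) 𝔽₂[x].⋆ 𝔽₂[x].coeff (redP q)) k                    ≡⟨ 𝔽₂[x].coeff-mulP (redP p) (redP q) k ⟨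
    𝔽₂[x].coeff (𝔽₂[x].mulP (redP p) (redP q)) k                             ∎

  redP-lift : ∀ s → redP (List.map lift s) ≡ s
  redP-lift []      = refl
  redP-lift (x ∷ s) = cong₂ _∷_ (red-lift x) (redP-lift s)

  reduces-to-0⇒even : ∀ D → redP D 𝔽₂[x].≋ [] → D ℤ₄[x].≋ ℤ₄[x].scaleP 2₄ (List.map halve D)
  reduces-to-0⇒even D D≡0 = ℤ₄[x].coeffwise λ k →
    trans (twice-halve _ (trans (sym (coeff-redP D k)) (𝔽₂[x].coeff-≡ D≡0 k)))
          (sym (trans (ℤ₄[x].coeff-scaleP 2₄ (List.map halve D) k) (cong (2₄ *₄_) (coeff-halve D k))))
    where
    coeff-halve : ∀ p k → ℤ₄[x].coeff (List.map halve p) k ≡ halve (ℤ₄[x].coeff p k)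
    coeff-halve []      k       = refl
    coeff-halve (a ∷ p) zero    = refl
    coeff-halve (a ∷ p) (suc k) = coeff-halve p k

-- In the Galois ring an element v with nonzero residue μ v is a unit:
-- invert μ v in K = 𝔽₂[x]/(h̄) (h̄ is irreducible), lift the inverse to get
-- s v = 1 + 2t in R, and note that 1 + 2t is a unit because 4 = 0.
module GaloisRingUnits (n : ℕ) (hl : Vec Z4 (suc n)) (irreducible : BasicIrreducible hl) where
  open Coordinates
  open GaloisRing n hl
  open GR (suc n) hl
  open Reduction
  open ℤ₄[x] using (addP; mulP; negP; scaleP; 1P; _≋_)
  open ≡.≡-Reasoning

  IsUnit : R → Set
  IsUnit v = Σ R λ e → v *R e ≡ 1R

  2R*2R≡0 : 2R *R 2R ≡ 0R
  2R*2R≡0 = begin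
    2R *R 2R            ≡⟨ 2R*v 2R ⟩
    2₄ ⊡ 2₄ ⊡ 1R        ≡⟨ ⊡-assoc 2₄ 2₄ 1R ⟩
    0₄ ⊡ 1R             ≡⟨ 0⊡v 1R ⟩
    0R                  ∎

  1+2t-inverse : ∀ t → (1R +R (2R *R t)) *R (1R +R (-R (2R *R t))) ≡ 1R
  1+2t-inverse t = begin
    (1R +R (2R *R t)) *R (1R +R (-R (2R *R t)))       ≡⟨ solve 2 (λ a t → (Κ (+ 1) ⊕ a ⊗ t) ⊗ (Κ (+ 1) ⊕ ⊝ (a ⊗ t))
                                                                       ⊜ Κ (+ 1) ⊕ ⊝ ((a ⊗ a) ⊗ (t ⊗ t))) refl 2R t ⟩
    1R +R (-R ((2R *R 2R) *R (t *R t)))              ≡⟨ cong (λ z → 1R +R (-R (z *R (t *R t)))) 2R*2R≡0 ⟩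
    1R +R (-R (0R *R (t *R t)))                      ≡⟨ solve 1 (λ u → Κ (+ 1) ⊕ ⊝ (Κ (+ 0) ⊗ u) ⊜ Κ (+ 1)) refl (t *R t) ⟩
    1R                                             ∎
    where open IntegerRingSolver R-ring using (solve; _⊜_; _⊕_; _⊗_; ⊝_; Κ)

  private
    coeff-++[1] : ∀ {k} (u : Vec F2 k) i → 𝔽₂[x].coeff (toList u ++ (1₂ ∷ [])) (k +ℕ i) ≡ 𝔽₂[x].coeff (1₂ ∷ []) i
    coeff-++[1] []      i = refl
    coeff-++[1] (a ∷ u) i = coeff-++[1] u i

  hbar-lead : 𝔽₂[x].coeff (hbar hl) m ≡ 1₂
  hbar-lead = subst (λ k → 𝔽₂[x].coeff (hbar hl) k ≡ 1₂) (ℕ.+-identityʳ m) (coeff-++[1] (map red hl) 0)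

  hbar-degree : 𝔽₂[x].DegreeBelow (hbar hl) (suc m)
  hbar-degree i = subst (λ k → 𝔽₂[x].coeff (hbar hl) k ≡ 0₂) (ℕ.+-suc m i) (coeff-++[1] (map red hl) (suc i))

  toList-degree : ∀ {k} (u : Vec F2 k) → 𝔽₂[x].DegreeBelow (toList u) k
  toList-degree []      i = refl
  toList-degree (a ∷ u) i = toList-degree u i

  toList-≋[] : ∀ {k} (u : Vec F2 k) → toList u 𝔽₂[x].≋ [] → u ≡ replicate k 0₂
  toList-≋[] []      _                  = refl
  toList-≋[] (a ∷ u) (𝔽₂[x].coeffwise e) = cong₂ _∷_ (e 0) (toList-≋[] u (𝔽₂[x].coeffwise λ i → e (suc i)))

  -- Lifting: an inverse s of μ v modulo h̄ lifts to S ∈ ℤ/4[x] with S(x) v = 1 + 2t,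
  -- since S V - (1 + C h) reduces to s w - (1 + c h̄) = 0 and so is twice a polynomial.
  lift-inverse : ∀ v s c → 𝔽₂[x].mulP s (toList (μ v)) 𝔽₂[x].≋ 𝔽₂[x].addP 𝔽₂[x].1P (𝔽₂[x].mulP c (hbar hl)) →
                 Σ R λ S → Σ R λ t → S *R v ≡ 1R +R (2R *R t)
  lift-inverse v s c sw≋1+ch = eval S , eval (List.map halve D) , Sv≡1+2t
    where
    w : List F2
    w = toList (μ v)
    S C X Y D : List Z4
    S = List.map lift s
    C = List.map lift c
    X = mulP S (toList v)
    Y = addP 1P (mulP C (hPoly hl))
    D = addP X (negP Y)
    redP-X : redP X 𝔽₂[x].≋ 𝔽₂[x].mulP s w
    redP-X = 𝔽₂[x].≋-trans (redP-mulP S (toList v))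
             (subst₂ (λ a b → 𝔽₂[x].mulP a b 𝔽₂[x].≋ 𝔽₂[x].mulP s w) (sym (redP-lift s)) (Vec.toList-map red v) 𝔽₂[x].≋-refl)
    redP-Y : redP Y 𝔽₂[x].≋ 𝔽₂[x].addP 𝔽₂[x].1P (𝔽₂[x].mulP c (hbar hl))
    redP-Y = 𝔽₂[x].≋-trans (redP-addP 1P (mulP C (hPoly hl)))
             (𝔽₂[x].addP-cong 𝔽₂[x].≋-refl (𝔽₂[x].≋-trans (redP-mulP C (hPoly hl))
               (subst₂ (λ a b → 𝔽₂[x].mulP a b 𝔽₂[x].≋ 𝔽₂[x].mulP c (hbar hl)) (sym (redP-lift c)) (sym redP-h) 𝔽₂[x].≋-refl)))
      where
      redP-h : redP (hPoly hl) ≡ hbar hl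
      redP-h = trans (List.map-++ red (toList hl) (1₄ ∷ [])) (cong (_++ (1₂ ∷ [])) (sym (Vec.toList-map red hl)))
    redP-D : redP D 𝔽₂[x].≋ []
    redP-D = 𝔽₂[x].≋-trans (redP-addP X (negP Y))
             (𝔽₂[x].≋-trans (𝔽₂[x].addP-cong (𝔽₂[x].≋-trans redP-X sw≋1+ch)
                                             (𝔽₂[x].≋-trans (redP-negP Y) (𝔽₂[x].negP-cong redP-Y)))
             (𝔽₂[x].≋-trans (𝔽₂[x].addP-comm Y' (𝔽₂[x].negP Y')) (𝔽₂[x].negP-inverseˡ Y')))
      where
      Y' : List F2
      Y' = 𝔽₂[x].addP 𝔽₂[x].1P (𝔽₂[x].mulP c (hbar hl))
    X≋Y+2D/2 : X ≋ addP Y (scaleP 2₄ (List.map halve D))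
    X≋Y+2D/2 = ℤ₄[x].≋-trans (solve 2 (λ x y → x ⊜ y ⊕ (x ⊕ ⊝ y)) ℤ₄[x].≋-refl X Y)
                              (ℤ₄[x].addP-cong ℤ₄[x].≋-refl (reduces-to-0⇒even D redP-D))
      where open ℤ₄[x].PolynomialSolver using (solve; _⊜_; _⊕_; ⊝_)
    eval-Y : eval Y ≡ 1R
    eval-Y = begin
      eval Y                                          ≡⟨ eval-addP 1P (mulP C (hPoly hl)) ⟩
      eval 1P +R eval (mulP C (hPoly hl))             ≡⟨ cong₂ _+R_ eval-1 (trans (eval-mulP C (hPoly hl)) (cong (eval C *R_) eval-h)) ⟩
      1R +R (eval C *R 0R)                            ≡⟨ cong (1R +R_) (CommutativeRing.zeroʳ R-ring (eval C)) ⟩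
      1R +R 0R                                        ≡⟨ ⊞-identityʳ 1R ⟩
      1R                                              ∎
    Sv≡1+2t : eval S *R v ≡ 1R +R (2R *R eval (List.map halve D))
    Sv≡1+2t = begin
      eval S *R v                                        ≡⟨ cong (eval S *R_) (toList-▸1 v) ⟨
      eval S *R eval (toList v)                          ≡⟨ eval-mulP S (toList v) ⟨
      eval X                                             ≡⟨ eval-cong X≋Y+2D/2 ⟩
      eval (addP Y (scaleP 2₄ (List.map halve D)))       ≡⟨ eval-addP Y (scaleP 2₄ (List.map halve D)) ⟩
      eval Y +R eval (scaleP 2₄ (List.map halve D))      ≡⟨ cong (eval Y +R_) (eval-scaleP 2₄ (List.map halve D)) ⟩
      eval Y +R (2₄ ⊡ eval (List.map halve D))           ≡⟨ cong₂ _+R_ eval-Y (sym (2R*v (eval (List.map halve D)))) ⟩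
      1R +R (2R *R eval (List.map halve D))              ∎

  inverse-mod-2 : ∀ v → ¬ (μ v ≡ 0K) → Σ R λ S → Σ R λ t → S *R v ≡ 1R +R (2R *R t)
  inverse-mod-2 v μv≢0 with InverseModulo.invertible m (hbar hl) irreducible hbar-lead hbar-degree
                              (toList (μ v)) (toList-degree (μ v)) (λ w≋0 → μv≢0 (toList-≋[] (μ v) w≋0))
  ... | s , c , sw≋1+ch = lift-inverse v s c sw≋1+ch

  unit-if-invertible-mod-2 : ∀ v → (Σ R λ s → Σ R λ t → s *R v ≡ 1R +R (2R *R t)) → IsUnit v
  unit-if-invertible-mod-2 v (s , t , sv≡1+2t) = s *R u , (begin
    v *R (s *R u)              ≡⟨ *R-assoc v s u ⟨
    (v *R s) *R u              ≡⟨ cong (_*R u) (*R-comm v s) ⟩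
    (s *R v) *R u              ≡⟨ cong (_*R u) sv≡1+2t ⟩
    (1R +R (2R *R t)) *R u     ≡⟨ 1+2t-inverse t ⟩
    1R                         ∎)
    where
    u : R
    u = 1R +R (-R (2R *R t))

  unit : ∀ v → ¬ (μ v ≡ 0K) → IsUnit v
  unit v μv≢0 = unit-if-invertible-mod-2 v (inverse-mod-2 v μv≢0)

module EvenOddArgument {A : Set} {_+_ _*_ : A → A → A} { -_ : A → A} {0# 1# : A}
  (laws : CommutativeRingLaws _≡_ _+_ _*_ -_ 0# 1#) where

  open Polynomials laws
  open PolynomialSolver using (solve; _⊜_; _⊕_; _⊗_; ⊝_; Κ)

  infixl 6 _+ₚ_
  infixl 7 _*ₚ_
  infix  8 -ₚ_

  _+ₚ_ _*ₚ_ : List A → List A → List A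
  _+ₚ_ = addP
  _*ₚ_ = mulP

  -ₚ_ : List A → List A
  -ₚ_ = negP

  2P : List A
  2P = 1P +ₚ 1P

  TwoInIdeal : List A → Set
  TwoInIdeal f = Σ (List A) λ α → Σ (List A) λ β → α *ₚ evenP f +ₚ β *ₚ oddP f ≋ 2P

  Coprime : List A → List A → Set
  Coprime P Q = Σ (List A) λ u → Σ (List A) λ v → u *ₚ P +ₚ v *ₚ Q ≋ 1P

  norm : List A → List A
  norm f = evenP f *ₚ evenP f +ₚ -ₚ (oddP f *ₚ oddP f)

  norm-parts : ∀ {f e o} → evenP f ≋ e → oddP f ≋ o → norm f ≋ e *ₚ e +ₚ -ₚ (o *ₚ o)
  norm-parts e≋ o≋ = addP-cong (mulP-cong e≋ e≋) (negP-cong (mulP-cong o≋ o≋))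

  norm-mulP : ∀ f g → norm (f *ₚ g) ≋ norm f *ₚ norm g
  norm-mulP f g = ≋-trans (norm-parts (evenP-mulP f g) (oddP-mulP f g))
    (solve 4 (λ fe fo ge go → (fe ⊗ ge ⊕ fo ⊗ go) ⊗ (fe ⊗ ge ⊕ fo ⊗ go) ⊕ ⊝ ((fe ⊗ go ⊕ fo ⊗ ge) ⊗ (fe ⊗ go ⊕ fo ⊗ ge))
                               ⊜ (fe ⊗ fe ⊕ ⊝ (fo ⊗ fo)) ⊗ (ge ⊗ ge ⊕ ⊝ (go ⊗ go)))
             ≋-refl (evenP f) (oddP f) (evenP g) (oddP g))

  norm-1P : norm 1P ≋ 1P
  norm-1P = ≋-trans (norm-parts ≋-refl [0]≋[]) (solve 0 (Κ (+ 1) ⊗ Κ (+ 1) ⊕ ⊝ (Κ (+ 0) ⊗ Κ (+ 0)) ⊜ Κ (+ 1)) ≋-refl)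

  coprime-sym : ∀ {P Q} → Coprime P Q → Coprime Q P
  coprime-sym {P} {Q} (u , v , uP+vQ≋1) = v , u , ≋-trans (addP-comm (v *ₚ Q) (u *ₚ P)) uP+vQ≋1

  coprime-1P : ∀ P → Coprime P 1P
  coprime-1P P = [] , 1P , mulP-identityˡ 1P

  coprime-congʳ : ∀ {P Q Q'} → Q ≋ Q' → Coprime P Q → Coprime P Q'
  coprime-congʳ {P} Q≋Q' (u , v , uP+vQ≋1) = u , v , ≋-trans (addP-cong {u *ₚ P} ≋-refl (mulP-cong {v} ≋-refl (≋-sym Q≋Q'))) uP+vQ≋1

  coprime-*ʳ : ∀ {P Q Q'} → Coprime P Q → Coprime P Q' → Coprime P (Q *ₚ Q')
  coprime-*ʳ {P} {Q} {Q'} (u , v , uP+vQ≋1) (u' , v' , u'P+v'Q'≋1) =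
    u *ₚ u' *ₚ P +ₚ u *ₚ v' *ₚ Q' +ₚ v *ₚ Q *ₚ u' , v *ₚ v' , ≋-trans
      (solve 7 (λ u v u' v' P Q Q' → (u ⊗ u' ⊗ P ⊕ u ⊗ v' ⊗ Q' ⊕ v ⊗ Q ⊗ u') ⊗ P ⊕ (v ⊗ v') ⊗ (Q ⊗ Q')
                                      ⊜ (u ⊗ P ⊕ v ⊗ Q) ⊗ (u' ⊗ P ⊕ v' ⊗ Q')) ≋-refl u v u' v' P Q Q')
      (≋-trans (mulP-cong uP+vQ≋1 u'P+v'Q'≋1) (mulP-identityˡ 1P))

  coprime-norm-powP : ∀ {P} f → Coprime P (norm f) → ∀ k → Coprime P (norm (powP f k 1#))
  coprime-norm-powP {P} f coprime zero    = coprime-congʳ (≋-sym norm-1P) (coprime-1P P)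
  coprime-norm-powP     f coprime (suc k) = coprime-congʳ (≋-sym (norm-mulP f (powP f k 1#)))
                                                          (coprime-*ʳ coprime (coprime-norm-powP f coprime k))

  prodP : (r : ℕ) → (Fin r → List A) → List A
  prodP zero    f = 1P
  prodP (suc r) f = f zero *ₚ prodP r (λ i → f (suc i))

  coprime-norm-prodP : ∀ {P} r (f : Fin r → List A) → (∀ i → Coprime P (norm (f i))) → Coprime P (norm (prodP r f))
  coprime-norm-prodP {P} zero    f coprime = coprime-congʳ (≋-sym norm-1P) (coprime-1P P)
  coprime-norm-prodP     (suc r) f coprime = coprime-congʳ (≋-sym (norm-mulP (f zero) (prodP r (λ i → f (suc i)))))
    (coprime-*ʳ (coprime zero) (coprime-norm-prodP r (λ i → f (suc i)) (λ i → coprime (suc i))))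

  twoInIdeal-*ₚ : ∀ f g → TwoInIdeal f → TwoInIdeal g → Coprime (norm f) (norm g) → TwoInIdeal (f *ₚ g)
  twoInIdeal-*ₚ f g (α , β , two-f) (α' , β' , two-g) (u , v , coprime) = X , Y , proof
    where
    fe fo ge go X Y : List A
    fe = evenP f ; fo = oddP f ; ge = evenP g ; go = oddP g
    X = u *ₚ α' *ₚ fe +ₚ -ₚ (u *ₚ β' *ₚ fo) +ₚ v *ₚ α *ₚ ge +ₚ -ₚ (v *ₚ β *ₚ go)
    Y = -ₚ (u *ₚ α' *ₚ fo) +ₚ u *ₚ β' *ₚ fe +ₚ -ₚ (v *ₚ α *ₚ go) +ₚ v *ₚ β *ₚ ge
    -- X (fg)_e + Y (fg)_o = u N(f) (α' g_e + β' g_o) + v N(g) (α f_e + β f_o) = (u N f + v N g) 2 = 2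
    proof : X *ₚ evenP (f *ₚ g) +ₚ Y *ₚ oddP (f *ₚ g) ≋ 2P
    proof = ≋-trans (addP-cong (mulP-cong {X} ≋-refl (evenP-mulP f g)) (mulP-cong {Y} ≋-refl (oddP-mulP f g)))
      (≋-trans (solve 10 (λ u v α β α' β' fe fo ge go →
            (u ⊗ α' ⊗ fe ⊕ ⊝ (u ⊗ β' ⊗ fo) ⊕ v ⊗ α ⊗ ge ⊕ ⊝ (v ⊗ β ⊗ go)) ⊗ (fe ⊗ ge ⊕ fo ⊗ go)
            ⊕ (⊝ (u ⊗ α' ⊗ fo) ⊕ u ⊗ β' ⊗ fe ⊕ ⊝ (v ⊗ α ⊗ go) ⊕ v ⊗ β ⊗ ge) ⊗ (fe ⊗ go ⊕ fo ⊗ ge)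
            ⊜ (u ⊗ (fe ⊗ fe ⊕ ⊝ (fo ⊗ fo))) ⊗ (α' ⊗ ge ⊕ β' ⊗ go) ⊕ (v ⊗ (ge ⊗ ge ⊕ ⊝ (go ⊗ go))) ⊗ (α ⊗ fe ⊕ β ⊗ fo))
            ≋-refl u v α β α' β' fe fo ge go)
      (≋-trans (addP-cong (mulP-cong {u *ₚ norm f} ≋-refl two-g) (mulP-cong {v *ₚ norm g} ≋-refl two-f))
      (≋-trans (≋-sym (mulP-distribʳ (u *ₚ norm f) (v *ₚ norm g) 2P))
      (≋-trans (mulP-cong coprime ≋-refl) (mulP-identityˡ 2P)))))

  linear : A → List A
  linear y = 1# ∷ (- y) ∷ []

  evenP-linear : ∀ y → evenP (linear y) ≋ 1P
  evenP-linear y = ∷-cong refl [0]≋[]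

  oddP-linear : ∀ y → oddP (linear y) ≋ 𝕫 *ₚ -ₚ const y
  oddP-linear y = ≋-sym (𝕫-mulP (const (- y)))

  norm-linear : ∀ y → norm (linear y) ≋ 1P +ₚ -ₚ ((𝕫 *ₚ 𝕫) *ₚ (const y *ₚ const y))
  norm-linear y = ≋-trans (norm-parts (evenP-linear y) (oddP-linear y))
    (solve 2 (λ z y → Κ (+ 1) ⊗ Κ (+ 1) ⊕ ⊝ ((z ⊗ ⊝ y) ⊗ (z ⊗ ⊝ y)) ⊜ Κ (+ 1) ⊕ ⊝ ((z ⊗ z) ⊗ (y ⊗ y))) ≋-refl 𝕫 (const y))

  const-*ₚ : ∀ a b → const a *ₚ const b ≋ const (a * b)
  const-*ₚ a b = ∷-cong (x+0≡x (a * b)) ≋-refl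

  coprime-norm-linear : ∀ y y' e → (((y' * y') + (- (y * y))) * e) ≡ 1# → Coprime (norm (linear y)) (norm (linear y'))
  coprime-norm-linear y y' e unit = const e *ₚ const y' *ₚ const y' , -ₚ (const e *ₚ const y *ₚ const y) , proof
    where
    proof : const e *ₚ const y' *ₚ const y' *ₚ norm (linear y) +ₚ -ₚ (const e *ₚ const y *ₚ const y) *ₚ norm (linear y') ≋ 1P
    proof = ≋-trans (addP-cong (mulP-cong {const e *ₚ const y' *ₚ const y'} ≋-refl (norm-linear y))
                               (mulP-cong { -ₚ (const e *ₚ const y *ₚ const y)} ≋-refl (norm-linear y')))
      (≋-trans (solve 4 (λ e y y' z → (e ⊗ y' ⊗ y') ⊗ (Κ (+ 1) ⊕ ⊝ ((z ⊗ z) ⊗ (y ⊗ y))) ⊕ ⊝ (e ⊗ y ⊗ y) ⊗ (Κ (+ 1) ⊕ ⊝ ((z ⊗ z) ⊗ (y' ⊗ y')))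
                                       ⊜ (y' ⊗ y' ⊕ ⊝ (y ⊗ y)) ⊗ e) ≋-refl (const e) (const y) (const y') 𝕫)
      (≋-trans (mulP-cong {q = const e} (addP-cong (const-*ₚ y' y') (negP-cong (const-*ₚ y y))) ≋-refl)
      (≋-trans (const-*ₚ ((y' * y') + (- (y * y))) e) (∷-cong unit ≋-refl))))

  twoInIdeal-linear : ∀ y k → k ≡ 1 ⊎ k ≡ 2 → TwoInIdeal (powP (linear y) k 1#)
  twoInIdeal-linear y .1 (inj₁ refl) =
    2P , [] , ≋-trans (addP-identityʳ _) (≋-trans (mulP-cong {2P} ≋-refl evenP-L) (≋-trans (mulP-comm 2P 1P) (mulP-identityˡ 2P)))
    where
    evenP-L : evenP (linear y *ₚ 1P) ≋ 1P
    evenP-L = ≋-trans (evenP-cong (≋-trans (mulP-comm (linear y) 1P) (mulP-identityˡ (linear y)))) (evenP-linear y)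
  twoInIdeal-linear y .2 (inj₂ refl) = 2P , 𝕫 *ₚ const y , proof
    where
    L : List A
    L = linear y
    L² : powP L 2 1# ≋ L *ₚ L
    L² = mulP-cong {L} ≋-refl (≋-trans (mulP-comm L 1P) (mulP-identityˡ L))
    evenP-L² : evenP (powP L 2 1#) ≋ 1P *ₚ 1P +ₚ (𝕫 *ₚ -ₚ const y) *ₚ (𝕫 *ₚ -ₚ const y)
    evenP-L² = ≋-trans (evenP-cong L²) (≋-trans (evenP-mulP L L)
                 (addP-cong (mulP-cong (evenP-linear y) (evenP-linear y)) (mulP-cong (oddP-linear y) (oddP-linear y))))
    oddP-L² : oddP (powP L 2 1#) ≋ 1P *ₚ (𝕫 *ₚ -ₚ const y) +ₚ (𝕫 *ₚ -ₚ const y) *ₚ 1P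
    oddP-L² = ≋-trans (oddP-cong L²) (≋-trans (oddP-mulP L L)
                (addP-cong (mulP-cong (evenP-linear y) (oddP-linear y)) (mulP-cong (oddP-linear y) (evenP-linear y))))
    proof : 2P *ₚ evenP (powP L 2 1#) +ₚ (𝕫 *ₚ const y) *ₚ oddP (powP L 2 1#) ≋ 2P
    proof = ≋-trans (addP-cong (mulP-cong {2P} ≋-refl evenP-L²) (mulP-cong {𝕫 *ₚ const y} ≋-refl oddP-L²))
      (solve 2 (λ z y → (Κ (+ 1) ⊕ Κ (+ 1)) ⊗ (Κ (+ 1) ⊗ Κ (+ 1) ⊕ (z ⊗ ⊝ y) ⊗ (z ⊗ ⊝ y))
                        ⊕ (z ⊗ y) ⊗ (Κ (+ 1) ⊗ (z ⊗ ⊝ y) ⊕ (z ⊗ ⊝ y) ⊗ Κ (+ 1))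
                        ⊜ Κ (+ 1) ⊕ Κ (+ 1)) ≋-refl 𝕫 (const y))

  Σ-poly : (r : ℕ) → (Fin r → A) → (Fin r → ℕ) → List A
  Σ-poly r Y a = prodP r (λ i → powP (linear (Y i)) (a i) 1#)

  twoInIdeal-Σ : ∀ r (Y : Fin r → A) (a : Fin r → ℕ) → (∀ i → a i ≡ 1 ⊎ a i ≡ 2) →
                 (∀ i j → ¬ (i ≡ j) → Σ A λ e → (((Y j * Y j) + (- (Y i * Y i))) * e) ≡ 1#) →
                 TwoInIdeal (Σ-poly r Y a)
  twoInIdeal-Σ zero    Y a a∈12 unit =
    2P , [] , ≋-trans (addP-identityʳ (2P *ₚ 1P)) (≋-trans (mulP-comm 2P 1P) (mulP-identityˡ 2P))
  twoInIdeal-Σ (suc r) Y a a∈12 unit =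
    twoInIdeal-*ₚ first rest (twoInIdeal-linear (Y zero) (a zero) (a∈12 zero))
      (twoInIdeal-Σ r (λ i → Y (suc i)) (λ i → a (suc i)) (λ i → a∈12 (suc i))
                    (λ i j i≢j → unit (suc i) (suc j) (λ si≡sj → i≢j (Fin.suc-injective si≡sj))))
      (coprime-norm-prodP r _ λ j → coprime-norm-powP (linear (Y (suc j)))
         (coprime-sym (coprime-norm-powP (linear (Y zero)) (coprime-sym (coprime-first j)) (a zero))) (a (suc j)))
    where
    first rest : List A
    first = powP (linear (Y zero)) (a zero) 1#
    rest  = Σ-poly r (λ i → Y (suc i)) (λ i → a (suc i))
    coprime-first : ∀ j → Coprime (norm (linear (Y zero))) (norm (linear (Y (suc j))))
    coprime-first j = let (e , e-inverse) = unit zero (suc j) (λ ()) in coprime-norm-linear (Y zero) (Y (suc j)) e e-inverse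

module GaloisRingHypotheses (n : ℕ) (hl : Vec Z4 (suc n)) (irreducible : BasicIrreducible hl) where
  open Coordinates
  open GaloisRing n hl
  open GaloisRingUnits n hl irreducible
  open GR (suc n) hl
  open ≡.≡-Reasoning

  μ-difference : ∀ {k} (u v : V k) → map red (u ⊞ ⊟ v) ≡ replicate k 0₂ → map red u ≡ map red v
  μ-difference []      []      _ = refl
  μ-difference (x ∷ u) (y ∷ v) e = cong₂ _∷_ (red-difference x y (cong Vec.head e)) (μ-difference u v (cong Vec.tail e))
    where
    red-difference : ∀ x y → red (x +₄ (-₄ y)) ≡ 0₂ → red x ≡ red y
    red-difference = toWitness {a? = all? λ x → all? λ y → (red (x +₄ (-₄ y)) ≟ 0₂) →-dec (red x ≟ red y)} tt

  -- u + v and u − v have the same residue, as −1 ≡ 1 mod 2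
  μ-sum : ∀ {k} (u v : V k) → map red (u ⊞ v) ≡ map red (u ⊞ ⊟ v)
  μ-sum []      []      = refl
  μ-sum (x ∷ u) (y ∷ v) = cong₂ _∷_ (toWitness {a? = all? λ x → all? λ y → red (x +₄ y) ≟ red (x +₄ (-₄ y))} tt x y) (μ-sum u v)

  difference-of-squares-unit : ∀ y y' → IsUnit (y' +R (-R y)) → IsUnit (y' +R y) → IsUnit ((y' *R y') +R (-R (y *R y)))
  difference-of-squares-unit y y' (e₁ , inverse₁) (e₂ , inverse₂) = e₁ *R e₂ , (begin
    ((y' *R y') +R (-R (y *R y))) *R (e₁ *R e₂)          ≡⟨ solve 4 (λ y y' e₁ e₂ → (y' ⊗ y' ⊕ ⊝ (y ⊗ y)) ⊗ (e₁ ⊗ e₂)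
                                                                                  ⊜ ((y' ⊕ ⊝ y) ⊗ e₁) ⊗ ((y' ⊕ y) ⊗ e₂)) refl y y' e₁ e₂ ⟩
    ((y' +R (-R y)) *R e₁) *R ((y' +R y) *R e₂)           ≡⟨ cong₂ _*R_ inverse₁ inverse₂ ⟩
    1R *R 1R                                              ≡⟨ toList-▸1 1R ⟩
    1R                                                    ∎)
    where open IntegerRingSolver R-ring using (solve; _⊜_; _⊕_; _⊗_; ⊝_)

  distinct-residues⇒unit : ∀ y y' → ¬ (μ y ≡ μ y') → IsUnit ((y' *R y') +R (-R (y *R y)))
  distinct-residues⇒unit y y' μy≢μy' = difference-of-squares-unit y y'
    (unit (y' +R (-R y)) (λ e → μy≢μy' (sym (μ-difference y' y e))))
    (unit (y' +R y) (λ e → μy≢μy' (sym (μ-difference y' y (trans (sym (μ-sum y' y)) e)))))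

  2R≡1R+1R : 2R ≡ 1R +R 1R
  2R≡1R+1R = twice 1R
    where
    twice : ∀ {k} (v : V k) → 2₄ ⊡ v ≡ v ⊞ v
    twice []      = refl
    twice (a ∷ v) = cong₂ _∷_ (toWitness {a? = all? λ a → (2₄ *₄ a) ≟ (a +₄ a)} tt a) (twice v)

  open EvenOddArgument R-laws
  open Polynomials R-laws using (coeff-≡; powP)

  Sigma≡Σ-poly : ∀ r Y a → Sigma r Y a ≡ Σ-poly r Y a
  Sigma≡Σ-poly zero    Y a = refl
  Sigma≡Σ-poly (suc r) Y a = cong (_*ₚ_ (powP (linear (Y zero)) (a zero) 1R)) (Sigma≡Σ-poly r (λ i → Y (suc i)) (λ i → a (suc i)))

  inIdeal : ∀ f → TwoInIdeal f → PR.InIdeal 2R (PR.evenP f) (PR.oddP f)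
  inIdeal f (α , β , two) = α , β , λ k → trans (coeff-≡ two k) (cong (λ c → PR.coeff (c ∷ []) k) (sym 2R≡1R+1R))

  twoInIdeal-Sigma : ∀ r (Y : Fin r → R) (a : Fin r → ℕ) → (∀ i → a i ≡ 1 ⊎ a i ≡ 2) →
                     (∀ i j → ¬ (i ≡ j) → ¬ (μ (Y i) ≡ μ (Y j))) →
                     PR.InIdeal 2R (PR.evenP (Sigma r Y a)) (PR.oddP (Sigma r Y a))
  twoInIdeal-Sigma r Y a a∈12 distinct =
    subst (λ f → PR.InIdeal 2R (PR.evenP f) (PR.oddP f)) (sym (Sigma≡Σ-poly r Y a))
      (inIdeal (Σ-poly r Y a) (twoInIdeal-Σ r Y a a∈12 λ i j i≢j → distinct-residues⇒unit (Y i) (Y j) (distinct i j i≢j)))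

-- The theorem, for R = GR(4, n + 1).
proposition5p8 : (m : ℕ) → 1 ≤ m → (hl : Vec Z4 m) → BasicIrreducible hl →
    (r : ℕ) → (Y : Fin r → GR.R m hl) → (a : Fin r → ℕ) →
    (∀ i → a i ≡ 1 ⊎ a i ≡ 2) →
    (∀ i → ¬ (GR.μ m hl (Y i) ≡ GR.0K m hl)) →
    (∀ i j → ¬ (i ≡ j) → ¬ (GR.μ m hl (Y i) ≡ GR.μ m hl (Y j))) →
    GR.PR.InIdeal m hl (GR.2R m hl)
    (GR.PR.evenP m hl (GR.Sigma m hl r Y a))
    (GR.PR.oddP m hl (GR.Sigma m hl r Y a))
proposition5p8 (suc n) (s≤s z≤n) hl irreducible r Y a a∈12 _ distinct =
  GaloisRingHypotheses.twoInIdeal-Sigma n hl irreducible r Y a a∈12 distinct
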